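{- For all integers $n \ge 20$ and $t \ge n-1$, \[ \Pr_{w\sim\mathcal{W}(1)}\Big[w^{(t)} = n,\ \max_{0\le r\le t} w^{(r)} = n,\ \min_{0\le r\le t} w^{(r)}\ge 1\Big] \le \min\Big\{\frac{e^{25}}{n^3},\ 64\Big(\frac{n}{t}\Big)^3\Big\}. \]
   Context: $\mathcal{W}(i)$ denotes the law of a simple symmetric random walk $(w^{(0)},w^{(1)},\dots)$ on $\mathbb{Z}$ started at $w^{(0)}=i$. Each step moves by $+1$ or $-1$ with probability $1/2$ each, independently of all other steps. -}

module Defs where

open import Data.Bool using (Bool; true; false)
open import Data.Nat as ℕ using (ℕ; zero; suc; _!)
open import Data.Nat.Properties using (m^n≢0; _!≢0)
open import Data.Integer as ℤ using (ℤ; +_; _⊔_; _⊓_)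
open import Data.Rational as ℚ using (ℚ; 0ℚ; 1ℚ)
open import Data.List as List using (List; []; _∷_; length; filter)
open import Data.List.NonEmpty as List⁺ using (List⁺; _∷_; foldr₁; last)
open import Data.Vec using (Vec; []; _∷_)
open import Data.Product using (_×_; _,_; ∃)
open import Relation.Nullary using (Dec)
open import Relation.Nullary.Decidable using (_×-dec_)
open import Relation.Unary using (Pred; Decidable)
open import Level using (0ℓ)

-- A walk of length t is determined by its step sequence, a Vec Bool t
-- (true = +1, false = -1); under W(i) all 2^t step sequences are
-- equally likely, so the probability of an event depending on
-- w^(0..t) is (#favourable step sequences) / 2^t.

stepℤ : Bool → ℤ
stepℤ true  = + 1
stepℤ false = ℤ.- (+ 1)

positions : ∀ {t} → ℤ → Vec Bool t → List⁺ ℤ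
positions i []       = i ∷ []
positions i (b ∷ bs) = i ∷ List⁺.toList (positions (i ℤ.+ stepℤ b) bs)

endPos : ∀ {t} → ℤ → Vec Bool t → ℤ
endPos i bs = last (positions i bs)

maxPos : ∀ {t} → ℤ → Vec Bool t → ℤ
maxPos i bs = foldr₁ _⊔_ (positions i bs)

minPos : ∀ {t} → ℤ → Vec Bool t → ℤ
minPos i bs = foldr₁ _⊓_ (positions i bs)

allSteps : (t : ℕ) → List (Vec Bool t)
allSteps zero    = [] ∷ []
allSteps (suc t) = List.map (true ∷_) (allSteps t) List.++ List.map (false ∷_) (allSteps t)

prob : (t : ℕ) → {E : Pred (Vec Bool t) 0ℓ} → Decidable E → ℚ
prob t E? = (+ length (filter E? (allSteps t)) ℚ./ (2 ℕ.^ t)) {{m^n≢0 2 t}}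

Event : (n t : ℕ) → Pred (Vec Bool t) 0ℓ
Event n t bs = (endPos (+ 1) bs ≡ + n) × (maxPos (+ 1) bs ≡ + n) × (+ 1 ℤ.≤ minPos (+ 1) bs)
  where open import Relation.Binary.PropositionalEquality using (_≡_)

event? : (n t : ℕ) → Decidable (Event n t)
event? n t bs = (endPos (+ 1) bs ℤ.≟ + n) ×-dec ((maxPos (+ 1) bs ℤ.≟ + n) ×-dec (+ 1 ℤ.≤? minPos (+ 1) bs))

infixr 8 _^ℚ_
_^ℚ_ : ℚ → ℕ → ℚ
q ^ℚ zero  = 1ℚ
q ^ℚ suc k = q ℚ.* (q ^ℚ k)

-- n / t as a rational; t = 0 never occurs in the theorem (t ≥ 19),
-- the value at 0 is an irrelevant junk value.
ratio : ℕ → ℕ → ℚ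
ratio n zero    = 0ℚ
ratio n (suc k) = + n ℚ./ suc k

expPartial : ℚ → ℕ → ℚ
expPartial x zero    = 0ℚ
expPartial x (suc K) = expPartial x K ℚ.+ (x ^ℚ K) ℚ.* ((+ 1 ℚ./ (K !)) {{K !≢0}})

-- q ≤ e^x * r, where e^x = lim_K expPartial x K (increasing limit) and r ≥ 0:
-- for every rational ε > 0 there is K with q ≤ expPartial x K * r + ε.
LeExpTimes : ℚ → (x : ℚ) → (r : ℚ) → Set
LeExpTimes q x r = ∀ (ε : ℚ) → 0ℚ ℚ.< ε →
  ∃ λ K → q ℚ.≤ expPartial x K ℚ.* r ℚ.+ ε

-- The event has probability 2^(-t) G_t(1), where G_t(x) counts the t-step paths from x to n
-- inside the strip {1, …, n}: G_t is the t-th power of the transfer operator of the walk killed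
-- outside the strip, applied to the indicator of n, and D_t is the same for the indicator of 1.
-- The operator is self-adjoint, so splitting a path at time a gives
-- G_(a+b)(1) = Σ_x G_a(x) D_b(x). The reflection principle bounds D_b(x) by a difference of
-- adjacent binomial coefficients, and unimodality of the binomial row turns this into the local
-- bound (b + 1) D_b(x) ≤ 4·2^b; reflecting the strip (x ↦ n + 1 − x) exchanges G and D.
-- For the first bound, (n + 1)³ ≤ 4 (x³ + (n + 1 − x)³) reduces n³ G_t(1) to the third moments
-- of D_a and D_b, which are at most (1 + 3a) 2^a; with a ≈ b ≈ t/2 this gives n³ G_t(1) ≤ 112·2^t.
-- For the second, the moments of G_a against x (n + 1 − x) and against a quartic weight have
-- negative discrete Laplacians and so lose mass at a fixed rate; this makes the total mass of
-- G_(2q) at most 2^(2q) n³ / (3 q²), and the local bound for the remaining q + r steps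
-- (t = 3q + r) gives t³ G_t(1) ≤ 64 n³ 2^t.

module Submission where

open import Data.Bool.Base using (Bool; true; false)
open import Data.Integer.Base as ℤ using (ℤ)
import Data.Integer.Properties as ℤ
open import Data.List.Base as List using ([]; _∷_; length; filter; map; _++_)
open import Data.List.NonEmpty.Base as List⁺ using (List⁺; _∷_; foldr₁; last)
open import Data.List.Properties using (filter-++; length-++; filter-≐; filter-accept; filter-reject; filter-none)
import Data.List.Relation.Unary.All as All
open import Data.Nat as ℕ
open import Data.Nat.Combinatorics using (_C_; nC1≡n; nCk+nC[k+1]≡[n+1]C[k+1])
open import Data.Nat.DivMod using (m≡m%n+[m/n]*n; m%n<n)
open import Data.Nat.Properties
open import Data.Nat.Tactic.RingSolver using (solve-∀)
open import Data.Product using (∃; _×_; _,_; proj₁; proj₂)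
open import Data.Rational.Base as ℚ using (ℚ)
import Data.Rational.Properties as ℚ
open import Data.Rational.Unnormalised.Base as ℚᵘ using (mkℚᵘ; *≤*; *≡*)
import Data.Rational.Unnormalised.Properties as ℚᵘ
open import Data.Sum using (_⊎_; inj₁; inj₂)
open import Data.Vec.Base using (Vec; []; _∷_)
open import Function.Base using (_∘_; id; const)
open import Level using (0ℓ)
open import Relation.Binary.PropositionalEquality
open import Relation.Nullary using (Dec; yes; no; ¬_; contradiction)
open import Relation.Nullary.Decidable using (_×-dec_; from-yes; from-no)
open import Relation.Unary using (Pred; Decidable)

open import Defs

even-or-odd : ∀ m → ∃ λ q → m ≡ q + q ⊎ m ≡ suc (q + q)
even-or-odd zero = 0 , inj₁ refl
even-or-odd (suc m) with even-or-odd m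
... | q , inj₁ m≡2q   = q , inj₂ (cong suc m≡2q)
... | q , inj₂ m≡2q+1 = suc q , inj₁ (trans (cong suc m≡2q+1) (sym (+-suc (suc q) q)))

1+2i≢2j : ∀ i j → suc (i + i) ≢ j + j
1+2i≢2j zero    zero    ()
1+2i≢2j zero    (suc j) eq rewrite +-suc j j with eq
... | ()
1+2i≢2j (suc i) zero    ()
1+2i≢2j (suc i) (suc j) eq rewrite +-suc i i | +-suc j j = 1+2i≢2j i j (suc-injective (suc-injective eq))

ceil-half : ∀ n → ∃ λ m → n ≤ m + m × m + m ≤ suc n
ceil-half n with even-or-odd n
... | q , inj₁ n≡2q   = q , ≤-reflexive n≡2q , ≤-trans (≤-reflexive (sym n≡2q)) (n≤1+n n)
... | q , inj₂ n≡2q+1 = suc q , ≤-trans (≤-reflexive n≡2q+1) (≤-trans (n≤1+n _) (≤-reflexive (sym (+-suc (suc q) q))))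
                      , ≤-reflexive (trans (+-suc (suc q) q) (cong suc (sym n≡2q+1)))

m+m≤1+j+j⇒m≤j : ∀ m j → m + m ≤ suc (j + j) → m ≤ j
m+m≤1+j+j⇒m≤j zero    j       _ = z≤n
m+m≤1+j+j⇒m≤j (suc m) zero    (s≤s le) rewrite +-suc m m with le
... | ()
m+m≤1+j+j⇒m≤j (suc m) (suc j) (s≤s le) rewrite +-suc m m | +-suc j j = s≤s (m+m≤1+j+j⇒m≤j m j (s≤s⁻¹ le))

∸-telescope : ∀ {a b c} → c ≤ b → b ≤ a → (a ∸ b) + (b ∸ c) ≡ a ∸ c
∸-telescope {a} {b} {c} c≤b b≤a = begin
  (a ∸ b) + (b ∸ c)   ≡⟨ +-∸-assoc (a ∸ b) c≤b ⟨
  (a ∸ b) + b ∸ c     ≡⟨ cong (_∸ c) (m∸n+n≡m b≤a) ⟩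
  a ∸ c               ∎
  where open ≡-Reasoning

doubling-bound : ∀ (s : ℕ → ℕ) → (∀ a → s (suc a) ≤ 2 * s a) → ∀ a → s a ≤ 2 ^ a * s 0
doubling-bound s grow zero    = ≤-reflexive (sym (+-identityʳ (s 0)))
doubling-bound s grow (suc a) = begin
  s (suc a)           ≤⟨ grow a ⟩
  2 * s a             ≤⟨ *-monoʳ-≤ 2 (doubling-bound s grow a) ⟩
  2 * (2 ^ a * s 0)   ≡⟨ *-assoc 2 (2 ^ a) (s 0) ⟨
  2 ^ suc a * s 0     ∎
  where open ≤-Reasoning

doubling-plus-bound : ∀ (s : ℕ → ℕ) → s 0 ≤ 1 → (∀ a → s (suc a) ≤ 2 * s a + 6 * 2 ^ a) →
                      ∀ a → s a ≤ (1 + 3 * a) * 2 ^ a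
doubling-plus-bound s s₀≤1 grow zero    = s₀≤1
doubling-plus-bound s s₀≤1 grow (suc a) = begin
  s (suc a)                               ≤⟨ grow a ⟩
  2 * s a + 6 * 2 ^ a                     ≤⟨ +-monoˡ-≤ (6 * 2 ^ a) (*-monoʳ-≤ 2 (doubling-plus-bound s s₀≤1 grow a)) ⟩
  2 * ((1 + 3 * a) * 2 ^ a) + 6 * 2 ^ a   ≡⟨ regroup a (2 ^ a) ⟩
  (1 + 3 * suc a) * 2 ^ suc a             ∎
  where
  open ≤-Reasoning
  regroup : ∀ a p → 2 * ((1 + 3 * a) * p) + 6 * p ≡ (1 + 3 * suc a) * (2 * p)
  regroup = solve-∀

doubling-minus-bound : ∀ (s e : ℕ → ℕ) c → (∀ a → s (suc a) ≤ 2 * s a) → (∀ a → e (suc a) + 2 * c * s a ≤ 2 * e a) →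
                       ∀ u v → e (u + v) + c * v * s (u + v) ≤ 2 ^ v * e u
doubling-minus-bound s e c grow lose u zero rewrite +-identityʳ u | *-zeroʳ c = ≤-refl
doubling-minus-bound s e c grow lose u (suc v) rewrite +-suc u v = begin
  e (suc w) + c * suc v * s (suc w)            ≤⟨ +-monoʳ-≤ (e (suc w)) (*-monoʳ-≤ (c * suc v) (grow w)) ⟩
  e (suc w) + c * suc v * (2 * s w)            ≡⟨ regroup (e (suc w)) c v (s w) ⟩
  e (suc w) + 2 * c * s w + 2 * (c * v * s w) ≤⟨ +-monoˡ-≤ _ (lose w) ⟩
  2 * e w + 2 * (c * v * s w)                  ≡⟨ *-distribˡ-+ 2 (e w) _ ⟨
  2 * (e w + c * v * s w)                      ≤⟨ *-monoʳ-≤ 2 (doubling-minus-bound s e c grow lose u v) ⟩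
  2 * (2 ^ v * e u)                            ≡⟨ *-assoc 2 (2 ^ v) (e u) ⟨
  2 ^ suc v * e u                              ∎
  where
  open ≤-Reasoning
  w = u + v
  regroup : ∀ x c v y → x + c * suc v * (2 * y) ≡ x + 2 * c * y + 2 * (c * v * y)
  regroup = solve-∀

-- 4 (x³ + y³) − (x + y)³ = 3 (x + y) (x − y)², written with y = x + w.
cube-split-slack : ∀ x w → (x + (x + w)) ^ 3 ≤ 4 * (x ^ 3 + (x + w) ^ 3)
cube-split-slack x w = subst ((x + (x + w)) ^ 3 ≤_) (sym (identity x w)) (m≤m+n _ _)
  where
  identity : ∀ x w → 4 * (x * (x * (x * 1)) + (x + w) * ((x + w) * ((x + w) * 1)))
                   ≡ (x + (x + w)) * ((x + (x + w)) * ((x + (x + w)) * 1)) + (6 * x * w * w + 3 * w * w * w)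
  identity = solve-∀

cube-split : ∀ x z → (x + z) ^ 3 ≤ 4 * (x ^ 3 + z ^ 3)
cube-split x z with ≤-total x z
... | inj₁ x≤z = subst (λ z → (x + z) ^ 3 ≤ 4 * (x ^ 3 + z ^ 3)) (m+[n∸m]≡n x≤z) (cube-split-slack x (z ∸ x))
... | inj₂ z≤x = subst₂ _≤_ (cong (_^ 3) (+-comm z x)) (cong (4 *_) (+-comm (z ^ 3) (x ^ 3)))
                   (subst (λ x → (z + x) ^ 3 ≤ 4 * (z ^ 3 + x ^ 3)) (m+[n∸m]≡n z≤x) (cube-split-slack z (x ∸ z)))

[3q+r]³≤32q²[1+q+r] : ∀ q r → 6 ≤ q → r ≤ 2 → (q + q + (q + r)) ^ 3 ≤ 32 * (q * q * suc (q + r))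
[3q+r]³≤32q²[1+q+r] q r 6≤q r≤2 = begin
  (q + q + (q + r)) ^ 3                      ≤⟨ ^-monoˡ-≤ 3 (+-monoʳ-≤ (q + q) (+-monoʳ-≤ q r≤2)) ⟩
  (q + q + (q + 2)) ^ 3                      ≡⟨ cong (λ m → (m + m + (m + 2)) ^ 3) (m∸n+n≡m 6≤q) ⟨
  (s + 6 + (s + 6) + (s + 6 + 2)) ^ 3        ≤⟨ m≤m+n _ _ ⟩
  (s + 6 + (s + 6) + (s + 6 + 2)) ^ 3 + (5 * s * s * s + 68 * s * s + 240 * s + 64) ≡⟨ identity s ⟩
  32 * ((s + 6) * (s + 6) * suc (s + 6))     ≡⟨ cong (λ m → 32 * (m * m * suc m)) (m∸n+n≡m 6≤q) ⟩
  32 * (q * q * suc q)                       ≤⟨ *-monoʳ-≤ 32 (*-monoʳ-≤ (q * q) (s≤s (m≤m+n q r))) ⟩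
  32 * (q * q * suc (q + r))                 ∎
  where
  open ≤-Reasoning
  s = q ∸ 6
  identity : ∀ s → (s + 6 + (s + 6) + (s + 6 + 2)) * ((s + 6 + (s + 6) + (s + 6 + 2)) * ((s + 6 + (s + 6) + (s + 6 + 2)) * 1))
                   + (5 * s * s * s + 68 * s * s + 240 * s + 64) ≡ 32 * ((s + 6) * (s + 6) * suc (s + 6))
  identity = solve-∀

pascal : ∀ n k → suc n C suc k ≡ n C k + n C suc k
pascal n k = sym (nCk+nC[k+1]≡[n+1]C[k+1] n k)

[1+k]*nC[1+k]+k*nCk≡n*nCk : ∀ n k → suc k * (n C suc k) + k * (n C k) ≡ n * (n C k)
[1+k]*nC[1+k]+k*nCk≡n*nCk zero    zero    = refl
[1+k]*nC[1+k]+k*nCk≡n*nCk zero    (suc k) = cong₂ _+_ (*-zeroʳ (2 + k)) (*-zeroʳ (suc k))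
[1+k]*nC[1+k]+k*nCk≡n*nCk (suc n) zero    = begin
  1 * (suc n C 1) + 0 ≡⟨ trans (+-identityʳ _) (*-identityˡ _) ⟩
  suc n C 1           ≡⟨ nC1≡n (suc n) ⟩
  suc n               ≡⟨ *-identityʳ (suc n) ⟨
  suc n * 1           ∎
  where open ≡-Reasoning
[1+k]*nC[1+k]+k*nCk≡n*nCk (suc n) (suc k) = begin
  2+k * (suc n C 2+k) + suc k * (suc n C suc k)
    ≡⟨ cong₂ (λ u v → 2+k * u + suc k * v) (pascal n (suc k)) (pascal n k) ⟩
  2+k * (y + z) + suc k * (x + y)
    ≡⟨ regroup k x y z ⟩
  (2+k * z + suc k * y) + (suc k * y + k * x) + (x + y)
    ≡⟨ cong₂ (λ u v → u + v + (x + y)) ([1+k]*nC[1+k]+k*nCk≡n*nCk n (suc k)) ([1+k]*nC[1+k]+k*nCk≡n*nCk n k) ⟩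
  n * y + n * x + (x + y)
    ≡⟨ collect n x y ⟩
  suc n * (x + y)
    ≡⟨ cong (suc n *_) (pascal n k) ⟨
  suc n * (suc n C suc k) ∎
  where
  open ≡-Reasoning
  2+k = suc (suc k)
  x = n C k
  y = n C suc k
  z = n C 2+k
  regroup : ∀ k x y z → suc (suc k) * (y + z) + suc k * (x + y) ≡ (suc (suc k) * z + suc k * y) + (suc k * y + k * x) + (x + y)
  regroup = solve-∀
  collect : ∀ n x y → n * y + n * x + (x + y) ≡ suc n * (x + y)
  collect = solve-∀

nC[1+k]≤nCk : ∀ n k → n ≤ suc (k + k) → n C suc k ≤ n C k
nC[1+k]≤nCk n k n≤2k+1 = *-cancelˡ-≤ (suc k) (+-cancelʳ-≤ (k * (n C k)) _ _ (begin
  suc k * (n C suc k) + k * (n C k) ≡⟨ [1+k]*nC[1+k]+k*nCk≡n*nCk n k ⟩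
  n * (n C k)                       ≤⟨ *-monoˡ-≤ (n C k) n≤2k+1 ⟩
  suc (k + k) * (n C k)             ≡⟨ *-distribʳ-+ (n C k) (suc k) k ⟩
  suc k * (n C k) + k * (n C k)     ∎))
  where open ≤-Reasoning

rowSum : ℕ → ℕ → ℕ
rowSum n zero    = 0
rowSum n (suc k) = rowSum n k + n C k

rowSum-suc : ∀ n k → rowSum (suc n) (suc k) ≡ rowSum n k + rowSum n (suc k)
rowSum-suc n zero    = refl
rowSum-suc n (suc k) = begin
  rowSum (suc n) (suc k) + suc n C suc k        ≡⟨ cong₂ _+_ (rowSum-suc n k) (pascal n k) ⟩
  rowSum n k + rowSum n (suc k) + (n C k + n C suc k) ≡⟨ shuffle (rowSum n k) (rowSum n (suc k)) (n C k) (n C suc k) ⟩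
  rowSum n (suc k) + (rowSum n (suc k) + n C suc k)  ∎
  where
  open ≡-Reasoning
  shuffle : ∀ a b c d → a + b + (c + d) ≡ (a + c) + (b + d)
  shuffle = solve-∀

rowSum≤2^n : ∀ n k → rowSum n k ≤ 2 ^ n
rowSum≤2^n zero    zero          = z≤n
rowSum≤2^n zero    (suc zero)    = ≤-refl
rowSum≤2^n zero    (suc (suc k)) = ≤-trans (≤-reflexive (+-identityʳ _)) (rowSum≤2^n zero (suc k))
rowSum≤2^n (suc n) zero          = z≤n
rowSum≤2^n (suc n) (suc k)       = begin
  rowSum (suc n) (suc k)        ≡⟨ rowSum-suc n k ⟩
  rowSum n k + rowSum n (suc k) ≤⟨ +-mono-≤ (rowSum≤2^n n k) (rowSum≤2^n n (suc k)) ⟩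
  2 ^ n + 2 ^ n                 ≡⟨ cong (2 ^ n +_) (+-identityʳ (2 ^ n)) ⟨
  2 ^ suc n                     ∎
  where open ≤-Reasoning

-- Past the middle of the row the coefficients decrease, so each one in the window
-- m ≤ i ≤ m + e dominates C(n, m + e).
window : ∀ n m e → n ≤ m + m → suc e * (n C (m + e)) + rowSum n m ≤ rowSum n (suc (m + e))
window n m zero n≤2m rewrite +-identityʳ m = ≤-reflexive (trans (+-comm (n C m + 0) (rowSum n m)) (cong (rowSum n m +_) (+-identityʳ _)))
window n m (suc e) n≤2m rewrite +-suc m e = begin
  c′ + suc e * c′ + rowSum n m   ≤⟨ +-monoˡ-≤ (rowSum n m) (+-monoʳ-≤ c′ (*-monoʳ-≤ (suc e) decreasing)) ⟩
  c′ + suc e * c + rowSum n m    ≡⟨ +-assoc c′ (suc e * c) (rowSum n m) ⟩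
  c′ + (suc e * c + rowSum n m)  ≤⟨ +-monoʳ-≤ c′ (window n m e n≤2m) ⟩
  c′ + rowSum n (suc (m + e))    ≡⟨ +-comm c′ _ ⟩
  rowSum n (suc (suc (m + e)))   ∎
  where
  open ≤-Reasoning
  c = n C (m + e)
  c′ = n C suc (m + e)
  decreasing : c′ ≤ c
  decreasing = nC[1+k]≤nCk n (m + e) (≤-trans n≤2m (≤-trans (+-mono-≤ (m≤m+n m e) (m≤m+n m e)) (n≤1+n _)))

[1+e]*nC[m+e]≤2^n : ∀ n m e → n ≤ m + m → suc e * (n C (m + e)) ≤ 2 ^ n
[1+e]*nC[m+e]≤2^n n m e n≤2m =
  ≤-trans (m≤m+n _ (rowSum n m)) (≤-trans (window n m e n≤2m) (rowSum≤2^n n (suc (m + e))))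

[1+d]*nCj≤2*2^n : ∀ n d j → n + d ≡ j + j → suc d * (n C j) ≤ 2 * 2 ^ n
[1+d]*nCj≤2*2^n n d j n+d≡2j with ceil-half n
... | m , n≤2m , 2m≤1+n = begin
  suc d * (n C j)               ≤⟨ *-monoˡ-≤ (n C j) 1+d≤2[1+e] ⟩
  2 * suc e * (n C j)           ≡⟨ cong (λ i → 2 * suc e * (n C i)) (sym m+e≡j) ⟩
  2 * suc e * (n C (m + e))     ≡⟨ *-assoc 2 (suc e) _ ⟩
  2 * (suc e * (n C (m + e)))   ≤⟨ *-monoʳ-≤ 2 ([1+e]*nC[m+e]≤2^n n m e n≤2m) ⟩
  2 * 2 ^ n                     ∎
  where
  open ≤-Reasoning
  m≤j : m ≤ j
  m≤j = m+m≤1+j+j⇒m≤j m j (≤-trans 2m≤1+n (s≤s (≤-trans (m≤m+n n d) (≤-reflexive n+d≡2j))))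
  e = j ∸ m
  m+e≡j : m + e ≡ j
  m+e≡j = m+[n∸m]≡n m≤j
  2m+d≤2m+1+2e : m + m + d ≤ m + m + suc (e + e)
  2m+d≤2m+1+2e = begin
    m + m + d                    ≤⟨ +-monoˡ-≤ d 2m≤1+n ⟩
    suc (n + d)                  ≡⟨ cong suc (trans n+d≡2j (cong (λ i → i + i) (sym m+e≡j))) ⟩
    suc ((m + e) + (m + e))      ≡⟨ regroup m e ⟩
    m + m + suc (e + e)          ∎
    where
    regroup : ∀ m e → suc ((m + e) + (m + e)) ≡ m + m + suc (e + e)
    regroup = solve-∀
  1+d≤2[1+e] : suc d ≤ 2 * suc e
  1+d≤2[1+e] = ≤-trans (s≤s (+-cancelˡ-≤ (m + m) _ _ 2m+d≤2m+1+2e)) (≤-reflexive (double e))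
    where
    double : ∀ e → suc (suc (e + e)) ≡ 2 * suc e
    double = solve-∀

ballot : ℕ → ℕ → ℕ
ballot n j = n C j ∸ n C suc j

[1+j]*ballot≡[1+d]*nCj : ∀ n d j → n + d ≡ j + j → suc j * ballot n j ≡ suc d * (n C j)
[1+j]*ballot≡[1+d]*nCj n d j n+d≡2j = begin
  suc j * (n C j ∸ n C suc j)             ≡⟨ *-distribˡ-∸ (suc j) (n C j) (n C suc j) ⟩
  suc j * (n C j) ∸ suc j * (n C suc j)   ≡⟨ cong (_∸ suc j * (n C suc j)) split ⟩
  suc j * (n C suc j) + suc d * (n C j) ∸ suc j * (n C suc j) ≡⟨ m+n∸m≡n (suc j * (n C suc j)) _ ⟩
  suc d * (n C j)                         ∎
  where
  open ≡-Reasoning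
  split : suc j * (n C j) ≡ suc j * (n C suc j) + suc d * (n C j)
  split = +-cancelʳ-≡ (j * (n C j)) _ _ (begin
    suc j * (n C j) + j * (n C j)                         ≡⟨ *-distribʳ-+ (n C j) (suc j) j ⟨
    suc (j + j) * (n C j)                                 ≡⟨ cong (λ i → suc i * (n C j)) n+d≡2j ⟨
    suc (n + d) * (n C j)                                 ≡⟨ regroup n d (n C j) ⟩
    n * (n C j) + suc d * (n C j)                         ≡⟨ cong (_+ suc d * (n C j)) ([1+k]*nC[1+k]+k*nCk≡n*nCk n j) ⟨
    suc j * (n C suc j) + j * (n C j) + suc d * (n C j)   ≡⟨ +-comm-right (suc j * (n C suc j)) (j * (n C j)) _ ⟩
    suc j * (n C suc j) + suc d * (n C j) + j * (n C j)   ∎)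
    where
    regroup : ∀ n d c → suc (n + d) * c ≡ n * c + suc d * c
    regroup = solve-∀
    +-comm-right : ∀ a b c → a + b + c ≡ a + c + b
    +-comm-right = solve-∀

[1+n]*ballot≤4*2^n : ∀ n d j → n + d ≡ j + j → suc n * ballot n j ≤ 4 * 2 ^ n
[1+n]*ballot≤4*2^n n d j n+d≡2j = begin
  suc n * ballot n j          ≤⟨ *-monoˡ-≤ (ballot n j) 1+n≤2[1+j] ⟩
  2 * suc j * ballot n j      ≡⟨ *-assoc 2 (suc j) (ballot n j) ⟩
  2 * (suc j * ballot n j)    ≡⟨ cong (2 *_) ([1+j]*ballot≡[1+d]*nCj n d j n+d≡2j) ⟩
  2 * (suc d * (n C j))       ≤⟨ *-monoʳ-≤ 2 ([1+d]*nCj≤2*2^n n d j n+d≡2j) ⟩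
  2 * (2 * 2 ^ n)             ≡⟨ *-assoc 2 2 (2 ^ n) ⟨
  4 * 2 ^ n                   ∎
  where
  open ≤-Reasoning
  1+n≤2[1+j] : suc n ≤ 2 * suc j
  1+n≤2[1+j] = ≤-trans (s≤s (≤-trans (m≤m+n n d) (≤-reflexive n+d≡2j))) (≤-trans (n≤1+n _) (≤-reflexive (double j)))
    where
    double : ∀ j → suc (suc (j + j)) ≡ 2 * suc j
    double = solve-∀

ballot-suc : ∀ n j → ballot (suc n) (suc j) ≡ n C j ∸ n C suc (suc j)
ballot-suc n j = begin
  suc n C suc j ∸ suc n C suc (suc j)                   ≡⟨ cong₂ _∸_ (pascal n j) (pascal n (suc j)) ⟩
  (n C j + n C suc j) ∸ (n C suc j + n C suc (suc j))   ≡⟨ cong (_∸ (n C suc j + n C suc (suc j))) (+-comm (n C j) _) ⟩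
  (n C suc j + n C j) ∸ (n C suc j + n C suc (suc j))   ≡⟨ [m+n]∸[m+o]≡n∸o (n C suc j) _ _ ⟩
  n C j ∸ n C suc (suc j)                               ∎
  where open ≡-Reasoning

δ : ℕ → ℕ → ℕ
δ s x with x ≟ s
... | yes _ = 1
... | no  _ = 0

δ-≡ : ∀ s → δ s s ≡ 1
δ-≡ s with s ≟ s
... | yes _  = refl
... | no s≢s = contradiction refl s≢s

δ-≢ : ∀ {s x} → x ≢ s → δ s x ≡ 0
δ-≢ {s} {x} x≢s with x ≟ s
... | yes x≡s = contradiction x≡s x≢s
... | no  _   = refl

δ≤1 : ∀ s x → δ s x ≤ 1
δ≤1 s x with x ≟ s
... | yes _ = ≤-refl
... | no  _ = z≤n

∑ : ℕ → (ℕ → ℕ) → ℕ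
∑ zero    f = 0
∑ (suc k) f = ∑ k f + f (suc k)

syntax ∑ k (λ x → e) = ∑[ x ∈1… k ] e

nbr : (ℕ → ℕ) → ℕ → ℕ
nbr f x = f (x ∸ 1) + f (suc x)

∑-cong : ∀ k {f g : ℕ → ℕ} → (∀ x → 1 ≤ x → x ≤ k → f x ≡ g x) → ∑ k f ≡ ∑ k g
∑-cong zero    _   = refl
∑-cong (suc k) f≡g = cong₂ _+_ (∑-cong k (λ x 1≤x x≤k → f≡g x 1≤x (m≤n⇒m≤1+n x≤k))) (f≡g (suc k) (s≤s z≤n) ≤-refl)

∑-mono-≤ : ∀ k {f g : ℕ → ℕ} → (∀ x → 1 ≤ x → x ≤ k → f x ≤ g x) → ∑ k f ≤ ∑ k g
∑-mono-≤ zero    _   = z≤n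
∑-mono-≤ (suc k) f≤g = +-mono-≤ (∑-mono-≤ k (λ x 1≤x x≤k → f≤g x 1≤x (m≤n⇒m≤1+n x≤k))) (f≤g (suc k) (s≤s z≤n) ≤-refl)

∑-+ : ∀ k (f g : ℕ → ℕ) → ∑[ x ∈1… k ] (f x + g x) ≡ ∑ k f + ∑ k g
∑-+ zero    f g = refl
∑-+ (suc k) f g = begin
  ∑[ x ∈1… k ] (f x + g x) + (f (suc k) + g (suc k)) ≡⟨ cong (_+ (f (suc k) + g (suc k))) (∑-+ k f g) ⟩
  ∑ k f + ∑ k g + (f (suc k) + g (suc k))            ≡⟨ shuffle (∑ k f) (∑ k g) (f (suc k)) (g (suc k)) ⟩
  ∑ k f + f (suc k) + (∑ k g + g (suc k))            ∎
  where
  open ≡-Reasoning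
  shuffle : ∀ a b c d → a + b + (c + d) ≡ a + c + (b + d)
  shuffle = solve-∀

∑-*ˡ : ∀ k c (f : ℕ → ℕ) → ∑[ x ∈1… k ] (c * f x) ≡ c * ∑ k f
∑-*ˡ zero    c f = sym (*-zeroʳ c)
∑-*ˡ (suc k) c f = trans (cong (_+ c * f (suc k)) (∑-*ˡ k c f)) (sym (*-distribˡ-+ c (∑ k f) (f (suc k))))

∑-by-parts : ∀ k (f g : ℕ → ℕ) →
  ∑[ x ∈1… k ] (nbr f x * g x) + f 1 * g 0 + f k * g (suc k) ≡
  ∑[ x ∈1… k ] (f x * nbr g x) + f 0 * g 1 + f (suc k) * g k
∑-by-parts zero    f g = +-comm (f 1 * g 0) (f 0 * g 1)
∑-by-parts (suc k) f g = begin
  L + nbr f (suc k) * g (suc k) + f 1 * g 0 + f (suc k) * g (suc (suc k))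
    ≡⟨ regroupˡ L (f k) (f (suc (suc k))) (g (suc k)) (f 1 * g 0) (f (suc k) * g (suc (suc k))) ⟩
  (L + f 1 * g 0 + f k * g (suc k)) + f (suc (suc k)) * g (suc k) + f (suc k) * g (suc (suc k))
    ≡⟨ cong (λ s → s + f (suc (suc k)) * g (suc k) + f (suc k) * g (suc (suc k))) (∑-by-parts k f g) ⟩
  (R + f 0 * g 1 + f (suc k) * g k) + f (suc (suc k)) * g (suc k) + f (suc k) * g (suc (suc k))
    ≡⟨ regroupʳ R (f 0 * g 1) (f (suc k)) (g k) (f (suc (suc k)) * g (suc k)) (g (suc (suc k))) ⟩
  R + f (suc k) * nbr g (suc k) + f 0 * g 1 + f (suc (suc k)) * g (suc k) ∎
  where
  open ≡-Reasoning
  L = ∑[ x ∈1… k ] (nbr f x * g x)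
  R = ∑[ x ∈1… k ] (f x * nbr g x)
  regroupˡ : ∀ L a b c d e → L + (a + b) * c + d + e ≡ (L + d + a * c) + b * c + e
  regroupˡ = solve-∀
  regroupʳ : ∀ R P a b Q c → (R + P + a * b) + Q + a * c ≡ R + a * (b + c) + P + Q
  regroupʳ = solve-∀

∑-δ-below : ∀ k (f : ℕ → ℕ) {r} → k < r → ∑[ x ∈1… k ] (f x * δ r x) ≡ 0
∑-δ-below zero    f k<r = refl
∑-δ-below (suc k) f k<r = begin
  ∑[ x ∈1… k ] (f x * δ _ x) + f (suc k) * δ _ (suc k) ≡⟨ cong₂ _+_ (∑-δ-below k f (<⇒≤ k<r)) (cong (f (suc k) *_) (δ-≢ (<⇒≢ k<r))) ⟩
  0 + f (suc k) * 0                                  ≡⟨ *-zeroʳ (f (suc k)) ⟩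
  0                                                  ∎
  where open ≡-Reasoning

∑-δ : ∀ k (f : ℕ → ℕ) {r} → 1 ≤ r → r ≤ k → ∑[ x ∈1… k ] (f x * δ r x) ≡ f r
∑-δ zero    f 1≤r r≤0 = contradiction (≤-trans 1≤r r≤0) λ ()
∑-δ (suc k) f {r} 1≤r r≤1+k with r ≟ suc k
... | yes refl = trans (cong₂ _+_ (∑-δ-below k f ≤-refl) (cong (f r *_) (δ-≡ r))) (*-identityʳ (f r))
... | no r≢1+k = begin
  ∑[ x ∈1… k ] (f x * δ r x) + f (suc k) * δ r (suc k) ≡⟨ cong₂ _+_ (∑-δ k f 1≤r (≤-pred (≤∧≢⇒< r≤1+k r≢1+k))) (cong (f (suc k) *_) (δ-≢ (r≢1+k ∘ sym))) ⟩
  f r + f (suc k) * 0                                  ≡⟨ cong (f r +_) (*-zeroʳ (f (suc k))) ⟩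
  f r + 0                                              ≡⟨ +-identityʳ (f r) ⟩
  f r                                                  ∎
  where open ≡-Reasoning

∑-suc : ∀ k (f : ℕ → ℕ) → ∑ (suc k) f ≡ f 1 + ∑[ x ∈1… k ] f (suc x)
∑-suc zero    f = +-comm 0 (f 1)
∑-suc (suc k) f = trans (cong (_+ f (suc (suc k))) (∑-suc k f)) (+-assoc (f 1) _ _)

∑-reflect : ∀ k (f : ℕ → ℕ) → ∑[ x ∈1… k ] f (suc k ∸ x) ≡ ∑ k f
∑-reflect zero    f = refl
∑-reflect (suc k) f = begin
  ∑[ x ∈1… suc k ] f (suc (suc k) ∸ x) ≡⟨ ∑-suc k (λ x → f (suc (suc k) ∸ x)) ⟩
  f (suc k) + ∑[ x ∈1… k ] f (suc k ∸ x) ≡⟨ cong (f (suc k) +_) (∑-reflect k f) ⟩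
  f (suc k) + ∑ k f                      ≡⟨ +-comm (f (suc k)) (∑ k f) ⟩
  ∑ (suc k) f                            ∎
  where open ≡-Reasoning

last-∷ : ∀ {A : Set} (x : A) (ys : List⁺ A) → last (x ∷ List⁺.toList ys) ≡ last ys
last-∷ x (y ∷ zs) with List.initLast zs
... | []             = refl
... | ws List.∷ʳ′ w  = refl

foldr₁-∷ : ∀ {A : Set} (f : A → A → A) x (ys : List⁺ A) → foldr₁ f (x ∷ List⁺.toList ys) ≡ f x (foldr₁ f ys)
foldr₁-∷ f x (y ∷ zs) = refl

last≤foldr₁-⊔ : ∀ (ys : List⁺ ℤ) → last ys ℤ.≤ foldr₁ ℤ._⊔_ ys
last≤foldr₁-⊔ (y ∷ zs) = go y zs
  where
  go : ∀ y zs → last (y ∷ zs) ℤ.≤ foldr₁ ℤ._⊔_ (y ∷ zs)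
  go y []       = ℤ.≤-refl
  go y (z ∷ zs) = ℤ.≤-trans (ℤ.≤-reflexive (last-∷ y (z ∷ zs))) (ℤ.≤-trans (go z zs) (ℤ.i≤j⊔i y _))

endPos-∷ : ∀ {t} i b (bs : Vec Bool t) → endPos i (b ∷ bs) ≡ endPos (i ℤ.+ stepℤ b) bs
endPos-∷ i b bs = last-∷ i (positions (i ℤ.+ stepℤ b) bs)

maxPos-∷ : ∀ {t} i b (bs : Vec Bool t) → maxPos i (b ∷ bs) ≡ i ℤ.⊔ maxPos (i ℤ.+ stepℤ b) bs
maxPos-∷ i b bs = foldr₁-∷ ℤ._⊔_ i (positions (i ℤ.+ stepℤ b) bs)

minPos-∷ : ∀ {t} i b (bs : Vec Bool t) → minPos i (b ∷ bs) ≡ i ℤ.⊓ minPos (i ℤ.+ stepℤ b) bs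
minPos-∷ i b bs = foldr₁-∷ ℤ._⊓_ i (positions (i ℤ.+ stepℤ b) bs)

endPos≤maxPos : ∀ {t} i (bs : Vec Bool t) → endPos i bs ℤ.≤ maxPos i bs
endPos≤maxPos i bs = last≤foldr₁-⊔ (positions i bs)

length-filter-map : ∀ {A B : Set} (f : A → B) {P : Pred B 0ℓ} (P? : Decidable P) xs →
                    length (filter P? (map f xs)) ≡ length (filter (P? ∘ f) xs)
length-filter-map f P? [] = refl
length-filter-map f P? (x ∷ xs) with P? (f x)
... | yes _ = cong suc (length-filter-map f P? xs)
... | no  _ = length-filter-map f P? xs

toℚᵘ-/ : ∀ a m .{{_ : NonZero m}} → ℚ.toℚᵘ (ℤ.+ a ℚ./ m) ℚᵘ.≃ mkℚᵘ (ℤ.+ a) (pred m)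
toℚᵘ-/ a (suc m-1) = ℚ.toℚᵘ-fromℚᵘ (mkℚᵘ (ℤ.+ a) m-1)

/-mono-≤ : ∀ a b c d .{{_ : NonZero b}} .{{_ : NonZero d}} → a * d ≤ c * b → ℤ.+ a ℚ./ b ℚ.≤ ℤ.+ c ℚ./ d
/-mono-≤ a b@(suc _) c d@(suc _) ad≤cb = ℚ.toℚᵘ-cancel-≤
  (ℚᵘ.≤-respˡ-≃ (ℚᵘ.≃-sym (toℚᵘ-/ a b)) (ℚᵘ.≤-respʳ-≃ (ℚᵘ.≃-sym (toℚᵘ-/ c d))
    (*≤* (subst₂ ℤ._≤_ (ℤ.pos-* a d) (ℤ.pos-* c b) (ℤ.+≤+ ad≤cb)))))

/-*-/ : ∀ a b c d .{{_ : NonZero b}} .{{_ : NonZero d}} →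
        (ℤ.+ a ℚ./ b) ℚ.* (ℤ.+ c ℚ./ d) ≡ (ℤ.+ (a * c) ℚ./ (b * d)) {{m*n≢0 b d}}
/-*-/ a b@(suc _) c d@(suc _) = ℚ.toℚᵘ-injective (begin
  ℚ.toℚᵘ ((ℤ.+ a ℚ./ b) ℚ.* (ℤ.+ c ℚ./ d))                 ≈⟨ ℚ.toℚᵘ-homo-* (ℤ.+ a ℚ./ b) (ℤ.+ c ℚ./ d) ⟩
  ℚ.toℚᵘ (ℤ.+ a ℚ./ b) ℚᵘ.* ℚ.toℚᵘ (ℤ.+ c ℚ./ d)            ≈⟨ ℚᵘ.*-cong (toℚᵘ-/ a b) (toℚᵘ-/ c d) ⟩
  mkℚᵘ (ℤ.+ a) (pred b) ℚᵘ.* mkℚᵘ (ℤ.+ c) (pred d)          ≈⟨ *≡* (cong (ℤ._* ℤ.+ (b * d)) (sym (ℤ.pos-* a c))) ⟩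
  mkℚᵘ (ℤ.+ (a * c)) (pred (b * d))                        ≈⟨ toℚᵘ-/ (a * c) (b * d) ⟨
  ℚ.toℚᵘ (ℤ.+ (a * c) ℚ./ (b * d))                         ∎)
  where open ℚᵘ.≃-Reasoning

/-^ℚ : ∀ a b k .{{_ : NonZero b}} → (ℤ.+ a ℚ./ b) ^ℚ k ≡ (ℤ.+ (a ^ k) ℚ./ (b ^ k)) {{m^n≢0 b k}}
/-^ℚ a b zero    = refl
/-^ℚ a b (suc k) = trans (cong ((ℤ.+ a ℚ./ b) ℚ.*_) (/-^ℚ a b k)) (/-*-/ a b (a ^ k) (b ^ k))
  where
  instance
    b^k≢0 : NonZero (b ^ k)
    b^k≢0 = m^n≢0 b k

p≤p+q : ∀ p {q} → ℚ.0ℚ ℚ.< q → p ℚ.≤ p ℚ.+ q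
p≤p+q p {q} 0<q = ℚ.≤-trans (ℚ.≤-reflexive (sym (ℚ.+-identityʳ p))) (ℚ.+-monoʳ-≤ p (ℚ.<⇒≤ 0<q))

-- The walk killed outside {1, …, n}

module Strip (n-1 : ℕ) where

  n : ℕ
  n = suc n-1

  N : ℕ
  N = suc n

  step : (ℕ → ℕ) → ℕ → ℕ
  step f zero    = 0
  step f (suc y) with suc y ≤? n
  ... | yes _ = nbr f (suc y)
  ... | no  _ = 0

  step-inside : ∀ f {x} → 1 ≤ x → x ≤ n → step f x ≡ nbr f x
  step-inside f {suc y} _ x≤n with suc y ≤? n
  ... | yes _   = refl
  ... | no  x≰n = contradiction x≤n x≰n

  step-outside : ∀ f {x} → n < x → step f x ≡ 0
  step-outside f {suc y} n<x with suc y ≤? n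
  ... | yes x≤n = contradiction x≤n (<⇒≱ n<x)
  ... | no  _   = refl

  step≤nbr : ∀ f x → step f x ≤ nbr f x
  step≤nbr f zero    = z≤n
  step≤nbr f (suc y) with suc y ≤? n
  ... | yes _ = ≤-refl
  ... | no  _ = z≤n

  Dirichlet : (ℕ → ℕ) → Set
  Dirichlet f = f 0 ≡ 0 × f N ≡ 0

  step-Dirichlet : ∀ f → Dirichlet (step f)
  step-Dirichlet f = refl , step-outside f ≤-refl

  ⟨_,_⟩ : (ℕ → ℕ) → (ℕ → ℕ) → ℕ
  ⟨ f , g ⟩ = ∑[ x ∈1… n ] (f x * g x)

  ⟨,⟩-comm : ∀ f g → ⟨ f , g ⟩ ≡ ⟨ g , f ⟩
  ⟨,⟩-comm f g = ∑-cong n (λ x _ _ → *-comm (f x) (g x))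

  ⟨,⟩-mono-≤ : ∀ f {g g′} → (∀ x → 1 ≤ x → x ≤ n → g x ≤ g′ x) → ⟨ f , g ⟩ ≤ ⟨ f , g′ ⟩
  ⟨,⟩-mono-≤ f g≤g′ = ∑-mono-≤ n (λ x 1≤x x≤n → *-monoʳ-≤ (f x) (g≤g′ x 1≤x x≤n))

  ⟨,+⟩ : ∀ f g h → ⟨ f , (λ x → g x + h x) ⟩ ≡ ⟨ f , g ⟩ + ⟨ f , h ⟩
  ⟨,+⟩ f g h = trans (∑-cong n (λ x _ _ → *-distribˡ-+ (f x) (g x) (h x))) (∑-+ n _ _)

  ⟨,*⟩ : ∀ f c g → ⟨ f , (λ x → c * g x) ⟩ ≡ c * ⟨ f , g ⟩
  ⟨,*⟩ f c g = trans (∑-cong n (λ x _ _ → x*[c*y]≡c*[x*y] (f x) c (g x))) (∑-*ˡ n c _)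
    where
    x*[c*y]≡c*[x*y] : ∀ x c y → x * (c * y) ≡ c * (x * y)
    x*[c*y]≡c*[x*y] = solve-∀

  ⟨δ,⟩ : ∀ {r} g → 1 ≤ r → r ≤ n → ⟨ δ r , g ⟩ ≡ g r
  ⟨δ,⟩ g 1≤r r≤n = trans (⟨,⟩-comm _ g) (∑-δ n g 1≤r r≤n)

  ⟨,⟩-≤-sup : ∀ c M f g w → (∀ x → 1 ≤ x → x ≤ n → c * f x ≤ M) →
              c * ⟨ f , (λ x → g x * w x) ⟩ ≤ M * ⟨ g , w ⟩
  ⟨,⟩-≤-sup c M f g w cf≤M = begin
    c * ⟨ f , (λ x → g x * w x) ⟩         ≡⟨ ∑-*ˡ n c _ ⟨
    ∑[ x ∈1… n ] (c * (f x * (g x * w x))) ≤⟨ ∑-mono-≤ n bound ⟩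
    ∑[ x ∈1… n ] (M * (g x * w x))        ≡⟨ ∑-*ˡ n M _ ⟩
    M * ⟨ g , w ⟩                          ∎
    where
    open ≤-Reasoning
    bound : ∀ x → 1 ≤ x → x ≤ n → c * (f x * (g x * w x)) ≤ M * (g x * w x)
    bound x 1≤x x≤n = ≤-trans (≤-reflexive (sym (*-assoc c (f x) _))) (*-monoˡ-≤ (g x * w x) (cf≤M x 1≤x x≤n))

  ⟨step,⟩-by-parts : ∀ f g → Dirichlet f → ⟨ step f , g ⟩ + f 1 * g 0 + f n * g N ≡ ⟨ f , nbr g ⟩
  ⟨step,⟩-by-parts f g (f₀≡0 , f_N≡0) = begin
    ⟨ step f , g ⟩ + f 1 * g 0 + f n * g N                            ≡⟨ cong (λ s → s + f 1 * g 0 + f n * g N) (∑-cong n λ x 1≤x x≤n → cong (_* g x) (step-inside f 1≤x x≤n)) ⟩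
    ∑[ x ∈1… n ] (nbr f x * g x) + f 1 * g 0 + f n * g N              ≡⟨ ∑-by-parts n f g ⟩
    ⟨ f , nbr g ⟩ + f 0 * g 1 + f N * g n                              ≡⟨ cong₂ (λ a b → ⟨ f , nbr g ⟩ + a * g 1 + b * g n) f₀≡0 f_N≡0 ⟩
    ⟨ f , nbr g ⟩ + 0 + 0                                              ≡⟨ trans (+-identityʳ _) (+-identityʳ _) ⟩
    ⟨ f , nbr g ⟩                                                      ∎
    where open ≡-Reasoning

  ⟨step,⟩≤⟨,nbr⟩ : ∀ f g → Dirichlet f → ⟨ step f , g ⟩ ≤ ⟨ f , nbr g ⟩
  ⟨step,⟩≤⟨,nbr⟩ f g f-D = ≤-trans (≤-trans (m≤m+n _ (f 1 * g 0)) (m≤m+n _ (f n * g N))) (≤-reflexive (⟨step,⟩-by-parts f g f-D))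

  step-self-adjoint : ∀ f g → Dirichlet f → Dirichlet g → ⟨ step f , g ⟩ ≡ ⟨ f , step g ⟩
  step-self-adjoint f g f-D (g₀≡0 , g_N≡0) = begin
    ⟨ step f , g ⟩                             ≡⟨ boundary-terms-vanish ⟨
    ⟨ step f , g ⟩ + f 1 * g 0 + f n * g N     ≡⟨ ⟨step,⟩-by-parts f g f-D ⟩
    ⟨ f , nbr g ⟩                              ≡⟨ ∑-cong n (λ x 1≤x x≤n → cong (f x *_) (sym (step-inside g 1≤x x≤n))) ⟩
    ⟨ f , step g ⟩                             ∎
    where
    open ≡-Reasoning
    boundary-terms-vanish : ⟨ step f , g ⟩ + f 1 * g 0 + f n * g N ≡ ⟨ step f , g ⟩
    boundary-terms-vanish rewrite g₀≡0 | g_N≡0 | *-zeroʳ (f 1) | *-zeroʳ (f n) = trans (+-identityʳ _) (+-identityʳ _)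

  moment-doubling : ∀ f g → Dirichlet f → (∀ x → 1 ≤ x → x ≤ n → nbr g x ≤ 2 * g x) →
                    ⟨ step f , g ⟩ ≤ 2 * ⟨ f , g ⟩
  moment-doubling f g f-D nbr≤ = begin
    ⟨ step f , g ⟩               ≤⟨ ⟨step,⟩≤⟨,nbr⟩ f g f-D ⟩
    ⟨ f , nbr g ⟩                ≤⟨ ⟨,⟩-mono-≤ f nbr≤ ⟩
    ⟨ f , (λ x → 2 * g x) ⟩      ≡⟨ ⟨,*⟩ f 2 g ⟩
    2 * ⟨ f , g ⟩                ∎
    where open ≤-Reasoning

  moment-doubling-plus : ∀ f g h → Dirichlet f → (∀ x → 1 ≤ x → x ≤ n → nbr g x ≤ 2 * g x + h x) →
                         ⟨ step f , g ⟩ ≤ 2 * ⟨ f , g ⟩ + ⟨ f , h ⟩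
  moment-doubling-plus f g h f-D nbr≤ = begin
    ⟨ step f , g ⟩                   ≤⟨ ⟨step,⟩≤⟨,nbr⟩ f g f-D ⟩
    ⟨ f , nbr g ⟩                    ≤⟨ ⟨,⟩-mono-≤ f nbr≤ ⟩
    ⟨ f , (λ x → 2 * g x + h x) ⟩    ≡⟨ ⟨,+⟩ f _ h ⟩
    ⟨ f , (λ x → 2 * g x) ⟩ + ⟨ f , h ⟩ ≡⟨ cong (_+ ⟨ f , h ⟩) (⟨,*⟩ f 2 g) ⟩
    2 * ⟨ f , g ⟩ + ⟨ f , h ⟩        ∎
    where open ≤-Reasoning

  moment-doubling-minus : ∀ f g h → Dirichlet f → (∀ x → 1 ≤ x → x ≤ n → nbr g x + h x ≤ 2 * g x) →
                          ⟨ step f , g ⟩ + ⟨ f , h ⟩ ≤ 2 * ⟨ f , g ⟩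
  moment-doubling-minus f g h f-D nbr+h≤ = begin
    ⟨ step f , g ⟩ + ⟨ f , h ⟩       ≤⟨ +-monoˡ-≤ ⟨ f , h ⟩ (⟨step,⟩≤⟨,nbr⟩ f g f-D) ⟩
    ⟨ f , nbr g ⟩ + ⟨ f , h ⟩        ≡⟨ ⟨,+⟩ f (nbr g) h ⟨
    ⟨ f , (λ x → nbr g x + h x) ⟩    ≤⟨ ⟨,⟩-mono-≤ f nbr+h≤ ⟩
    ⟨ f , (λ x → 2 * g x) ⟩          ≡⟨ ⟨,*⟩ f 2 g ⟩
    2 * ⟨ f , g ⟩                    ∎
    where open ≤-Reasoning

  -- paths t s x counts the t-step walks between x and s that stay in {1, …, n}.
  paths : ℕ → ℕ → ℕ → ℕ
  paths zero    s = δ s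
  paths (suc t) s = step (paths t s)

  paths-Dirichlet : ∀ t {s} → 1 ≤ s → s ≤ n → Dirichlet (paths t s)
  paths-Dirichlet zero    1≤s s≤n = δ-≢ (λ 0≡s → contradiction (subst (1 ≤_) (sym 0≡s) 1≤s) λ ())
                                  , δ-≢ (λ N≡s → contradiction (subst (_≤ n) (sym N≡s) s≤n) (n≮n n))
  paths-Dirichlet (suc t) _   _   = step-Dirichlet _

  paths≤2^t : ∀ t s x → paths t s x ≤ 2 ^ t
  paths≤2^t zero    s x = δ≤1 s x
  paths≤2^t (suc t) s x = begin
    step (paths t s) x                      ≤⟨ step≤nbr (paths t s) x ⟩
    paths t s (x ∸ 1) + paths t s (suc x)   ≤⟨ +-mono-≤ (paths≤2^t t s _) (paths≤2^t t s _) ⟩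
    2 ^ t + 2 ^ t                           ≡⟨ cong (2 ^ t +_) (+-identityʳ (2 ^ t)) ⟨
    2 ^ suc t                               ∎
    where open ≤-Reasoning

  ⟨paths,paths⟩-shift : ∀ a b c {s r} → 1 ≤ s → s ≤ n → 1 ≤ r → r ≤ n →
                        ⟨ paths (a + b) s , paths c r ⟩ ≡ ⟨ paths a s , paths (b + c) r ⟩
  ⟨paths,paths⟩-shift a zero    c _   _   _   _   rewrite +-identityʳ a = refl
  ⟨paths,paths⟩-shift a (suc b) c {s} {r} 1≤s s≤n 1≤r r≤n = begin
    ⟨ paths (a + suc b) s , paths c r ⟩         ≡⟨ cong (λ t → ⟨ paths t s , paths c r ⟩) (+-suc a b) ⟩
    ⟨ paths (suc a + b) s , paths c r ⟩         ≡⟨ ⟨paths,paths⟩-shift (suc a) b c 1≤s s≤n 1≤r r≤n ⟩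
    ⟨ step (paths a s) , paths (b + c) r ⟩      ≡⟨ step-self-adjoint _ _ (paths-Dirichlet a 1≤s s≤n) (paths-Dirichlet (b + c) 1≤r r≤n) ⟩
    ⟨ paths a s , step (paths (b + c) r) ⟩      ∎
    where open ≡-Reasoning

  paths-+ : ∀ a b {s r} → 1 ≤ s → s ≤ n → 1 ≤ r → r ≤ n → paths (a + b) s r ≡ ⟨ paths a s , paths b r ⟩
  paths-+ a b {s} {r} 1≤s s≤n 1≤r r≤n = begin
    paths (a + b) s r                        ≡⟨ ∑-δ n (paths (a + b) s) 1≤r r≤n ⟨
    ⟨ paths (a + b) s , paths 0 r ⟩          ≡⟨ ⟨paths,paths⟩-shift a b 0 1≤s s≤n 1≤r r≤n ⟩
    ⟨ paths a s , paths (b + 0) r ⟩          ≡⟨ cong (λ t → ⟨ paths a s , paths t r ⟩) (+-identityʳ b) ⟩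
    ⟨ paths a s , paths b r ⟩                ∎
    where open ≡-Reasoning

  distances : ∀ y → suc y ≤ n →
              ∃ λ z → N ≡ suc (suc y + z) × N ∸ y ≡ suc (suc z) × N ∸ suc y ≡ suc z × N ∸ suc (suc y) ≡ z
  distances y 1+y≤n = z , N≡2+y+z
    , trans (cong (_∸ y) (trans N≡2+y+z (sym (trans (+-suc y (suc z)) (cong suc (+-suc y z)))))) (m+n∸m≡n y (suc (suc z)))
    , trans (cong (_∸ suc y) (trans N≡2+y+z (cong suc (sym (+-suc y z))))) (m+n∸m≡n (suc y) (suc z))
    , trans (cong (_∸ suc (suc y)) N≡2+y+z) (m+n∸m≡n (suc (suc y)) z)
    where
    z = n ∸ suc y
    N≡2+y+z : N ≡ suc (suc y + z)
    N≡2+y+z = cong suc (sym (m+[n∸m]≡n 1+y≤n))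

  paths-reflect : ∀ t x → x ≤ N → paths t n x ≡ paths t 1 (N ∸ x)
  paths-reflect zero x x≤N = δ-reflect (x ≟ n)
    where
    δ-reflect : Dec (x ≡ n) → δ n x ≡ δ 1 (N ∸ x)
    δ-reflect (yes refl) = trans (δ-≡ n) (sym (trans (cong (δ 1) (m+n∸n≡m 1 n)) (δ-≡ 1)))
    δ-reflect (no  x≢n)  = trans (δ-≢ x≢n) (sym (δ-≢ λ N∸x≡1 → x≢n (sym (suc-injective (trans (sym (m∸n+n≡m x≤N)) (cong (_+ x) N∸x≡1))))))
  paths-reflect (suc t) zero    _   = sym (proj₂ (step-Dirichlet (paths t 1)))
  paths-reflect (suc t) (suc y) x≤N = reflect-step (suc y ≤? n)
    where
    open ≡-Reasoning
    reflect-step : Dec (suc y ≤ n) → step (paths t n) (suc y) ≡ step (paths t 1) (N ∸ suc y)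
    reflect-step (no x≰n) = begin
      step (paths t n) (suc y)     ≡⟨ step-outside _ (≰⇒> x≰n) ⟩
      step (paths t 1) 0           ≡⟨ cong (step (paths t 1)) (trans (cong (N ∸_) (≤-antisym x≤N (≰⇒> x≰n))) (n∸n≡0 N)) ⟨
      step (paths t 1) (N ∸ suc y) ∎
    reflect-step (yes x≤n) with distances y x≤n
    ... | z , N≡2+y+z , N∸y≡2+z , N∸x≡1+z , N∸[2+y]≡z = begin
      step (paths t n) (suc y)                           ≡⟨ step-inside _ (s≤s z≤n) x≤n ⟩
      paths t n y + paths t n (suc (suc y))              ≡⟨ cong₂ _+_ (paths-reflect t y (m≤n⇒m≤1+n (≤-trans (n≤1+n y) x≤n)))
                                                                      (paths-reflect t (suc (suc y)) (s≤s x≤n)) ⟩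
      paths t 1 (N ∸ y) + paths t 1 (N ∸ suc (suc y))    ≡⟨ cong₂ (λ u v → paths t 1 u + paths t 1 v) N∸y≡2+z N∸[2+y]≡z ⟩
      paths t 1 (suc (suc z)) + paths t 1 z              ≡⟨ +-comm _ (paths t 1 z) ⟩
      nbr (paths t 1) (suc z)                            ≡⟨ step-inside _ (s≤s z≤n) 1+z≤n ⟨
      step (paths t 1) (suc z)                           ≡⟨ cong (step (paths t 1)) N∸x≡1+z ⟨
      step (paths t 1) (N ∸ suc y)                       ∎
      where
      1+z≤n : suc z ≤ n
      1+z≤n = s≤s⁻¹ (subst (suc (suc z) ≤_) (sym N≡2+y+z) (s≤s (s≤s (m≤n+m z y))))

  paths-1-parity : ∀ t x j → x + t ≡ j + j → paths t 1 x ≡ 0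
  paths-1-parity zero    x       j       x+0≡2j = δ-≢ (λ x≡1 → 1+2i≢2j 0 j (trans (sym (cong (_+ 0) x≡1)) x+0≡2j))
  paths-1-parity (suc t) zero    j       _      = refl
  paths-1-parity (suc t) (suc y) zero    ()
  paths-1-parity (suc t) (suc y) (suc j) x+t≡2j = n≤0⇒n≡0 (begin
    step (paths t 1) (suc y)                   ≤⟨ step≤nbr (paths t 1) (suc y) ⟩
    paths t 1 y + paths t 1 (suc (suc y))      ≡⟨ cong₂ _+_ (paths-1-parity t y j y+t≡2j) (paths-1-parity t (suc (suc y)) (suc j) [2+y]+t≡2[1+j]) ⟩
    0                                          ∎)
    where
    open ≤-Reasoning
    y+t≡2j : y + t ≡ j + j
    y+t≡2j = suc-injective (trans (sym (+-suc y t)) (trans (suc-injective x+t≡2j) (+-suc j j)))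
    [2+y]+t≡2[1+j] : suc (suc y) + t ≡ suc j + suc j
    [2+y]+t≡2[1+j] = trans (cong suc (sym (+-suc y t))) x+t≡2j

  -- The reflection principle, in the form of an upper bound: the upper killing boundary N is dropped.
  paths-1≤ballot : ∀ t x j → x + t ≡ suc (j + j) → paths t 1 x ≤ ballot t j
  paths-1≤ballot zero    x       zero    _ = δ≤1 1 x
  paths-1≤ballot zero    x       (suc j) x+0≡1+2[1+j] =
    ≤-reflexive (δ-≢ λ x≡1 → 0≢1+n (suc-injective (trans (sym (cong (_+ 0) x≡1)) x+0≡1+2[1+j])))
  paths-1≤ballot (suc t) zero    j       _ = z≤n
  paths-1≤ballot (suc t) (suc y) zero    x+t≡1 = contradiction (trans (sym (+-suc y t)) (suc-injective x+t≡1)) λ ()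
  paths-1≤ballot (suc t) (suc y) (suc j) x+t≡1+2[1+j] = begin
    step (paths t 1) (suc y)                   ≤⟨ step≤nbr (paths t 1) (suc y) ⟩
    paths t 1 y + paths t 1 (suc (suc y))      ≤⟨ neighbours y y+t≡1+2j [2+y]+t≡1+2[1+j] ⟩
    t C j ∸ t C suc (suc j)                    ≡⟨ ballot-suc t j ⟨
    ballot (suc t) (suc j)                     ∎
    where
    open ≤-Reasoning
    y+t≡1+2j : y + t ≡ suc (j + j)
    y+t≡1+2j = trans (suc-injective (trans (sym (+-suc y t)) (suc-injective x+t≡1+2[1+j]))) (+-suc j j)
    [2+y]+t≡1+2[1+j] : suc (suc y) + t ≡ suc (suc j + suc j)
    [2+y]+t≡1+2[1+j] = trans (cong suc (sym (+-suc y t))) x+t≡1+2[1+j]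
    C[1+j]≤Cj : t C suc j ≤ t C j
    C[1+j]≤Cj = nC[1+k]≤nCk t j (≤-trans (m≤n+m t y) (≤-reflexive y+t≡1+2j))
    C[2+j]≤C[1+j] : t C suc (suc j) ≤ t C suc j
    C[2+j]≤C[1+j] = nC[1+k]≤nCk t (suc j) (≤-trans (m≤n+m t y) (≤-trans (≤-reflexive y+t≡1+2j) (s≤s (≤-trans (+-monoʳ-≤ j (n≤1+n j)) (n≤1+n _)))))
    neighbours : ∀ y → y + t ≡ suc (j + j) → suc (suc y) + t ≡ suc (suc j + suc j) →
                 paths t 1 y + paths t 1 (suc (suc y)) ≤ t C j ∸ t C suc (suc j)
    neighbours zero    _ e₂ = begin
      paths t 1 0 + paths t 1 2   ≡⟨ cong (_+ paths t 1 2) (proj₁ (paths-Dirichlet t ≤-refl (s≤s z≤n))) ⟩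
      paths t 1 2                 ≤⟨ paths-1≤ballot t 2 (suc j) e₂ ⟩
      ballot t (suc j)            ≤⟨ ∸-monoˡ-≤ (t C suc (suc j)) C[1+j]≤Cj ⟩
      t C j ∸ t C suc (suc j)     ∎
    neighbours (suc y) e₁ e₂ = begin
      paths t 1 (suc y) + paths t 1 (suc (suc (suc y)))  ≤⟨ +-mono-≤ (paths-1≤ballot t (suc y) j e₁) (paths-1≤ballot t (suc (suc (suc y))) (suc j) e₂) ⟩
      ballot t j + ballot t (suc j)                      ≡⟨ ∸-telescope C[2+j]≤C[1+j] C[1+j]≤Cj ⟩
      t C j ∸ t C suc (suc j)                            ∎

  [1+t]*paths-1≤4*2^t : ∀ t x → suc t * paths t 1 x ≤ 4 * 2 ^ t
  [1+t]*paths-1≤4*2^t t x with even-or-odd (x + t)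
  ... | j , inj₁ x+t≡2j = ≤-trans (≤-reflexive (trans (cong (suc t *_) (paths-1-parity t x j x+t≡2j)) (*-zeroʳ (suc t)))) z≤n
  [1+t]*paths-1≤4*2^t t zero    | j , inj₂ _ =
    ≤-trans (≤-reflexive (trans (cong (suc t *_) (proj₁ (paths-Dirichlet t ≤-refl (s≤s z≤n)))) (*-zeroʳ (suc t)))) z≤n
  [1+t]*paths-1≤4*2^t t (suc y) | j , inj₂ x+t≡1+2j =
    ≤-trans (*-monoʳ-≤ (suc t) (paths-1≤ballot t (suc y) j x+t≡1+2j))
            ([1+n]*ballot≤4*2^n t y j (trans (+-comm t y) (suc-injective x+t≡1+2j)))

  [1+t]*paths-n≤4*2^t : ∀ t x → x ≤ N → suc t * paths t n x ≤ 4 * 2 ^ t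
  [1+t]*paths-n≤4*2^t t x x≤N rewrite paths-reflect t x x≤N = [1+t]*paths-1≤4*2^t t (N ∸ x)

  quadratic : ℕ → ℕ
  quadratic x = x * (N ∸ x)

  -- N² + 1 makes the constant terms of the second differences of quadratic² and quadratic cancel.
  quartic : ℕ → ℕ
  quartic x = quadratic x * (N * N + 1 + quadratic x)

  nbr-quadratic : ∀ x → 1 ≤ x → x ≤ n → nbr quadratic x + 2 ≤ 2 * quadratic x
  nbr-quadratic (suc y) _ x≤n with distances y x≤n
  ... | z , _ , N∸y≡2+z , N∸x≡1+z , N∸[2+y]≡z = ≤-reflexive (begin
    y * (N ∸ y) + suc (suc y) * (N ∸ suc (suc y)) + 2  ≡⟨ cong₂ (λ u v → y * u + suc (suc y) * v + 2) N∸y≡2+z N∸[2+y]≡z ⟩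
    y * suc (suc z) + suc (suc y) * z + 2              ≡⟨ identity y z ⟩
    2 * (suc y * suc z)                                ≡⟨ cong (λ u → 2 * (suc y * u)) N∸x≡1+z ⟨
    2 * (suc y * (N ∸ suc y))                          ∎)
    where
    open ≡-Reasoning
    identity : ∀ y z → y * suc (suc z) + suc (suc y) * z + 2 ≡ 2 * (suc y * suc z)
    identity = solve-∀

  nbr-quartic : ∀ x → 1 ≤ x → x ≤ n → nbr quartic x + 12 * quadratic x ≤ 2 * quartic x
  nbr-quartic (suc y) _ x≤n with distances y x≤n
  ... | z , N≡2+y+z , N∸y≡2+z , N∸x≡1+z , N∸[2+y]≡z = ≤-reflexive (begin
    q y (N ∸ y) + q (suc (suc y)) (N ∸ suc (suc y)) + 12 * (suc y * (N ∸ suc y))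
      ≡⟨ cong₂ (λ u v → q y u + q (suc (suc y)) v + 12 * (suc y * (N ∸ suc y))) N∸y≡2+z N∸[2+y]≡z ⟩
    q y (suc (suc z)) + q (suc (suc y)) z + 12 * (suc y * (N ∸ suc y))
      ≡⟨ cong₂ (λ M c → y * suc (suc z) * (M * M + 1 + y * suc (suc z)) + suc (suc y) * z * (M * M + 1 + suc (suc y) * z) + 12 * (suc y * c)) N≡2+y+z N∸x≡1+z ⟩
    y * suc (suc z) * (M′ * M′ + 1 + y * suc (suc z)) + suc (suc y) * z * (M′ * M′ + 1 + suc (suc y) * z) + 12 * (suc y * suc z)
      ≡⟨ identity y z ⟩
    2 * (suc y * suc z * (M′ * M′ + 1 + suc y * suc z))
      ≡⟨ cong₂ (λ M c → 2 * (suc y * c * (M * M + 1 + suc y * c))) N≡2+y+z N∸x≡1+z ⟨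
    2 * quartic (suc y) ∎)
    where
    open ≡-Reasoning
    q : ℕ → ℕ → ℕ
    q x d = x * d * (N * N + 1 + x * d)
    M′ = suc (suc y + z)
    identity : ∀ y z → y * suc (suc z) * (suc (suc y + z) * suc (suc y + z) + 1 + y * suc (suc z))
                       + suc (suc y) * z * (suc (suc y + z) * suc (suc y + z) + 1 + suc (suc y) * z) + 12 * (suc y * suc z)
                     ≡ 2 * (suc y * suc z * (suc (suc y + z) * suc (suc y + z) + 1 + suc y * suc z))
    identity = solve-∀

  nbr-id : ∀ x → 1 ≤ x → x ≤ n → nbr id x ≤ 2 * x
  nbr-id (suc y) _ _ = ≤-reflexive (identity y)
    where
    identity : ∀ y → y + suc (suc y) ≡ 2 * suc y
    identity = solve-∀

  nbr-cube : ∀ x → 1 ≤ x → x ≤ n → nbr (_^ 3) x ≤ 2 * x ^ 3 + 6 * x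
  nbr-cube (suc y) _ _ = ≤-reflexive (identity y)
    where
    identity : ∀ y → y * (y * (y * 1)) + suc (suc y) * (suc (suc y) * (suc (suc y) * 1))
                     ≡ 2 * (suc y * (suc y * (suc y * 1))) + 6 * suc y
    identity = solve-∀

  mass : ℕ → ℕ
  mass a = ⟨ paths a n , const 1 ⟩

  mass-doubling : ∀ a → mass (suc a) ≤ 2 * mass a
  mass-doubling a = moment-doubling _ (const 1) (paths-Dirichlet a (s≤s z≤n) ≤-refl) (λ _ _ _ → ≤-refl)

  third-moment≤ : ∀ b → ⟨ paths b 1 , _^ 3 ⟩ ≤ (1 + 3 * b) * 2 ^ b
  third-moment≤ = doubling-plus-bound (λ b → ⟨ paths b 1 , _^ 3 ⟩) (≤-reflexive (⟨δ,⟩ (_^ 3) ≤-refl (s≤s z≤n))) λ b →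
    let D-b = paths-Dirichlet b ≤-refl (s≤s z≤n) in begin
    ⟨ paths (suc b) 1 , _^ 3 ⟩                           ≤⟨ moment-doubling-plus _ (_^ 3) (6 *_) D-b nbr-cube ⟩
    2 * ⟨ paths b 1 , _^ 3 ⟩ + ⟨ paths b 1 , (6 *_) ⟩    ≡⟨ cong (2 * ⟨ paths b 1 , _^ 3 ⟩ +_) (⟨,*⟩ (paths b 1) 6 id) ⟩
    2 * ⟨ paths b 1 , _^ 3 ⟩ + 6 * ⟨ paths b 1 , id ⟩    ≤⟨ +-monoʳ-≤ (2 * ⟨ paths b 1 , _^ 3 ⟩) (*-monoʳ-≤ 6 (first-moment≤ b)) ⟩
    2 * ⟨ paths b 1 , _^ 3 ⟩ + 6 * 2 ^ b                 ∎
    where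
    open ≤-Reasoning
    first-moment≤ : ∀ b → ⟨ paths b 1 , id ⟩ ≤ 2 ^ b
    first-moment≤ b = ≤-trans
      (doubling-bound (λ b → ⟨ paths b 1 , id ⟩) (λ b → moment-doubling _ id (paths-Dirichlet b ≤-refl (s≤s z≤n)) nbr-id) b)
      (≤-reflexive (trans (cong (2 ^ b *_) (⟨δ,⟩ id ≤-refl (s≤s z≤n))) (*-identityʳ (2 ^ b))))

  moment₂ : ℕ → ℕ
  moment₂ a = ⟨ paths a n , quadratic ⟩

  moment₄ : ℕ → ℕ
  moment₄ a = ⟨ paths a n , quartic ⟩

  moment₂-loss : ∀ a → moment₂ (suc a) + 2 * 1 * mass a ≤ 2 * moment₂ a
  moment₂-loss a = subst (λ m → moment₂ (suc a) + m ≤ 2 * moment₂ a) (⟨,*⟩ (paths a n) 2 (const 1))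
    (moment-doubling-minus _ quadratic (const 2) (paths-Dirichlet a (s≤s z≤n) ≤-refl) nbr-quadratic)

  moment₄-loss : ∀ a → moment₄ (suc a) + 2 * 6 * moment₂ a ≤ 2 * moment₄ a
  moment₄-loss a = subst (λ m → moment₄ (suc a) + m ≤ 2 * moment₄ a) (⟨,*⟩ (paths a n) 12 quadratic)
    (moment-doubling-minus _ quartic (λ x → 12 * quadratic x) (paths-Dirichlet a (s≤s z≤n) ≤-refl) nbr-quartic)

  mass-decay : ∀ u v → 6 * u * v * mass (u + v) ≤ 2 ^ (u + v) * quartic n
  mass-decay u v = begin
    6 * u * v * mass (u + v)          ≡⟨ *-assoc (6 * u) v _ ⟩
    6 * u * (v * mass (u + v))        ≤⟨ *-monoʳ-≤ (6 * u) v*mass≤ ⟩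
    6 * u * (2 ^ v * moment₂ u)       ≡⟨ x*[y*z]≡y*[x*z] (6 * u) (2 ^ v) (moment₂ u) ⟩
    2 ^ v * (6 * u * moment₂ u)       ≤⟨ *-monoʳ-≤ (2 ^ v) u*moment₂≤ ⟩
    2 ^ v * (2 ^ u * moment₄ 0)       ≡⟨ cong (λ m → 2 ^ v * (2 ^ u * m)) (⟨δ,⟩ quartic (s≤s z≤n) ≤-refl) ⟩
    2 ^ v * (2 ^ u * quartic n)       ≡⟨ *-assoc (2 ^ v) (2 ^ u) _ ⟨
    2 ^ v * 2 ^ u * quartic n         ≡⟨ cong (_* quartic n) (trans (*-comm (2 ^ v) (2 ^ u)) (sym (^-distribˡ-+-* 2 u v))) ⟩
    2 ^ (u + v) * quartic n           ∎
    where
    open ≤-Reasoning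
    x*[y*z]≡y*[x*z] : ∀ x y z → x * (y * z) ≡ y * (x * z)
    x*[y*z]≡y*[x*z] = solve-∀
    moment₂-doubling : ∀ a → moment₂ (suc a) ≤ 2 * moment₂ a
    moment₂-doubling a = ≤-trans (m≤m+n _ _) (moment₂-loss a)
    v*mass≤ : v * mass (u + v) ≤ 2 ^ v * moment₂ u
    v*mass≤ = ≤-trans (≤-trans (≤-reflexive (cong (_* mass (u + v)) (sym (*-identityˡ v)))) (m≤n+m _ _))
                      (doubling-minus-bound mass moment₂ 1 mass-doubling moment₂-loss u v)
    u*moment₂≤ : 6 * u * moment₂ u ≤ 2 ^ u * moment₄ 0
    u*moment₂≤ = ≤-trans (m≤n+m _ _) (doubling-minus-bound moment₂ moment₄ 6 moment₂-doubling moment₄-loss 0 u)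

  [1+b]*paths≤4*2^b*mass : ∀ a b → suc b * paths (a + b) n 1 ≤ 4 * 2 ^ b * mass a
  [1+b]*paths≤4*2^b*mass a b = begin
    suc b * paths (a + b) n 1                          ≡⟨ cong (suc b *_) (paths-+ a b (s≤s z≤n) ≤-refl ≤-refl (s≤s z≤n)) ⟩
    suc b * ⟨ paths a n , paths b 1 ⟩                  ≡⟨ cong (suc b *_) (∑-cong n λ x _ _ → x*y≡y*[x*1] (paths a n x) (paths b 1 x)) ⟩
    suc b * ⟨ paths b 1 , (λ x → paths a n x * 1) ⟩    ≤⟨ ⟨,⟩-≤-sup (suc b) _ (paths b 1) (paths a n) (const 1) (λ x _ _ → [1+t]*paths-1≤4*2^t b x) ⟩
    4 * 2 ^ b * mass a                                 ∎
    where
    open ≤-Reasoning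
    x*y≡y*[x*1] : ∀ x y → x * y ≡ y * (x * 1)
    x*y≡y*[x*1] = solve-∀

  paths-decay : ∀ u v b → u * v * (suc b * paths (u + v + b) n 1) ≤ 2 ^ (u + v + b) * quartic n
  paths-decay u v b = begin
    u * v * (suc b * paths (u + v + b) n 1)   ≤⟨ *-monoʳ-≤ (u * v) ([1+b]*paths≤4*2^b*mass (u + v) b) ⟩
    u * v * (4 * 2 ^ b * mass (u + v))        ≡⟨ regroup u v (2 ^ b) (mass (u + v)) ⟩
    2 ^ b * (4 * u * v * mass (u + v))        ≤⟨ *-monoʳ-≤ (2 ^ b) (*-monoˡ-≤ (mass (u + v)) (*-monoˡ-≤ v (*-monoˡ-≤ u (m≤m+n 4 2)))) ⟩
    2 ^ b * (6 * u * v * mass (u + v))        ≤⟨ *-monoʳ-≤ (2 ^ b) (mass-decay u v) ⟩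
    2 ^ b * (2 ^ (u + v) * quartic n)         ≡⟨ *-assoc (2 ^ b) _ _ ⟨
    2 ^ b * 2 ^ (u + v) * quartic n           ≡⟨ cong (_* quartic n) (trans (*-comm (2 ^ b) _) (sym (^-distribˡ-+-* 2 (u + v) b))) ⟩
    2 ^ (u + v + b) * quartic n               ∎
    where
    open ≤-Reasoning
    regroup : ∀ u v p m → u * v * (4 * p * m) ≡ p * (4 * u * v * m)
    regroup = solve-∀

  ⟨paths-n,reflected⟩ : ∀ a g → ⟨ paths a n , (λ x → g (N ∸ x)) ⟩ ≡ ⟨ paths a 1 , g ⟩
  ⟨paths-n,reflected⟩ a g = begin
    ⟨ paths a n , (λ x → g (N ∸ x)) ⟩              ≡⟨ ∑-cong n (λ x _ x≤n → cong (_* g (N ∸ x)) (paths-reflect a x (m≤n⇒m≤1+n x≤n))) ⟩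
    ∑[ x ∈1… n ] (paths a 1 (N ∸ x) * g (N ∸ x))   ≡⟨ ∑-reflect n (λ y → paths a 1 y * g y) ⟩
    ⟨ paths a 1 , g ⟩                              ∎
    where open ≡-Reasoning

  N³*⟨paths,paths⟩≤ : ∀ a b → N ^ 3 * ⟨ paths a n , paths b 1 ⟩ ≤
                      4 * ⟨ paths a n , (λ x → paths b 1 x * x ^ 3) ⟩ + 4 * ⟨ paths b 1 , (λ x → paths a n x * (N ∸ x) ^ 3) ⟩
  N³*⟨paths,paths⟩≤ a b = begin
    N ^ 3 * ⟨ paths a n , paths b 1 ⟩                     ≡⟨ ∑-*ˡ n (N ^ 3) _ ⟨
    ∑[ x ∈1… n ] (N ^ 3 * (paths a n x * paths b 1 x))   ≤⟨ ∑-mono-≤ n pointwise ⟩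
    ∑[ x ∈1… n ] (4 * (paths a n x * (paths b 1 x * x ^ 3)) + 4 * (paths b 1 x * (paths a n x * (N ∸ x) ^ 3)))
                                                         ≡⟨ ∑-+ n _ _ ⟩
    ∑[ x ∈1… n ] (4 * (paths a n x * (paths b 1 x * x ^ 3))) + ∑[ x ∈1… n ] (4 * (paths b 1 x * (paths a n x * (N ∸ x) ^ 3)))
                                                         ≡⟨ cong₂ _+_ (∑-*ˡ n 4 _) (∑-*ˡ n 4 _) ⟩
    4 * ⟨ paths a n , (λ x → paths b 1 x * x ^ 3) ⟩ + 4 * ⟨ paths b 1 , (λ x → paths a n x * (N ∸ x) ^ 3) ⟩ ∎
    where
    open ≤-Reasoning
    pointwise : ∀ x → 1 ≤ x → x ≤ n → N ^ 3 * (paths a n x * paths b 1 x) ≤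
                4 * (paths a n x * (paths b 1 x * x ^ 3)) + 4 * (paths b 1 x * (paths a n x * (N ∸ x) ^ 3))
    pointwise x _ x≤n = begin
      N ^ 3 * (G * D)                          ≡⟨ cong (λ m → m ^ 3 * (G * D)) (m+[n∸m]≡n (m≤n⇒m≤1+n x≤n)) ⟨
      (x + (N ∸ x)) ^ 3 * (G * D)              ≤⟨ *-monoˡ-≤ (G * D) (cube-split x (N ∸ x)) ⟩
      4 * (x ^ 3 + (N ∸ x) ^ 3) * (G * D)      ≡⟨ distribute G D (x ^ 3) ((N ∸ x) ^ 3) ⟩
      4 * (G * (D * x ^ 3)) + 4 * (D * (G * (N ∸ x) ^ 3)) ∎
      where
      G = paths a n x
      D = paths b 1 x
      distribute : ∀ G D p q → 4 * (p + q) * (G * D) ≡ 4 * (G * (D * p)) + 4 * (D * (G * q))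
      distribute = solve-∀

  [1+a][1+b]*N³*paths≤ : ∀ a b → suc a * suc b * (N ^ 3 * paths (a + b) n 1) ≤
                                 16 * 2 ^ (a + b) * (suc b * (1 + 3 * b) + suc a * (1 + 3 * a))
  [1+a][1+b]*N³*paths≤ a b = begin
    suc a * suc b * (N ^ 3 * paths (a + b) n 1)          ≡⟨ cong (λ p → suc a * suc b * (N ^ 3 * p)) (paths-+ a b (s≤s z≤n) ≤-refl ≤-refl (s≤s z≤n)) ⟩
    suc a * suc b * (N ^ 3 * ⟨ paths a n , paths b 1 ⟩)  ≤⟨ *-monoʳ-≤ (suc a * suc b) (N³*⟨paths,paths⟩≤ a b) ⟩
    suc a * suc b * (4 * Σ₁ + 4 * Σ₂)                    ≡⟨ regroup (suc a) (suc b) Σ₁ Σ₂ ⟩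
    4 * suc b * (suc a * Σ₁) + 4 * suc a * (suc b * Σ₂)  ≤⟨ +-mono-≤ (*-monoʳ-≤ (4 * suc b) bound₁) (*-monoʳ-≤ (4 * suc a) bound₂) ⟩
    4 * suc b * (4 * 2 ^ a * ((1 + 3 * b) * 2 ^ b)) + 4 * suc a * (4 * 2 ^ b * ((1 + 3 * a) * 2 ^ a))
                                                         ≡⟨ collect a b (2 ^ a) (2 ^ b) ⟩
    16 * (2 ^ a * 2 ^ b) * (suc b * (1 + 3 * b) + suc a * (1 + 3 * a))
                                                         ≡⟨ cong (λ p → 16 * p * (suc b * (1 + 3 * b) + suc a * (1 + 3 * a))) (^-distribˡ-+-* 2 a b) ⟨
    16 * 2 ^ (a + b) * (suc b * (1 + 3 * b) + suc a * (1 + 3 * a)) ∎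
    where
    open ≤-Reasoning
    Σ₁ = ⟨ paths a n , (λ x → paths b 1 x * x ^ 3) ⟩
    Σ₂ = ⟨ paths b 1 , (λ x → paths a n x * (N ∸ x) ^ 3) ⟩
    regroup : ∀ A B s t → A * B * (4 * s + 4 * t) ≡ 4 * B * (A * s) + 4 * A * (B * t)
    regroup = solve-∀
    collect : ∀ a b p q → 4 * suc b * (4 * p * ((1 + 3 * b) * q)) + 4 * suc a * (4 * q * ((1 + 3 * a) * p))
                        ≡ 16 * (p * q) * (suc b * (1 + 3 * b) + suc a * (1 + 3 * a))
    collect = solve-∀
    bound₁ : suc a * Σ₁ ≤ 4 * 2 ^ a * ((1 + 3 * b) * 2 ^ b)
    bound₁ = ≤-trans (⟨,⟩-≤-sup (suc a) (4 * 2 ^ a) (paths a n) (paths b 1) (_^ 3)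
                                (λ x _ x≤n → [1+t]*paths-n≤4*2^t a x (m≤n⇒m≤1+n x≤n)))
                     (*-monoʳ-≤ (4 * 2 ^ a) (third-moment≤ b))
    bound₂ : suc b * Σ₂ ≤ 4 * 2 ^ b * ((1 + 3 * a) * 2 ^ a)
    bound₂ = ≤-trans (⟨,⟩-≤-sup (suc b) (4 * 2 ^ b) (paths b 1) (paths a n) (λ x → (N ∸ x) ^ 3)
                                (λ x _ _ → [1+t]*paths-1≤4*2^t b x))
                     (*-monoʳ-≤ (4 * 2 ^ b) (≤-trans (≤-reflexive (⟨paths-n,reflected⟩ a (_^ 3))) (third-moment≤ a)))
  N³*paths≤112*2^t : ∀ t → N ^ 3 * paths t n 1 ≤ 112 * 2 ^ t
  N³*paths≤112*2^t t with even-or-odd t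
  ... | q , inj₁ refl = *-cancelˡ-≤ (suc q * suc q) (begin
    suc q * suc q * (N ^ 3 * paths (q + q) n 1)                           ≤⟨ [1+a][1+b]*N³*paths≤ q q ⟩
    16 * 2 ^ (q + q) * (suc q * (1 + 3 * q) + suc q * (1 + 3 * q))        ≤⟨ m≤m+n _ _ ⟩
    16 * 2 ^ (q + q) * (suc q * (1 + 3 * q) + suc q * (1 + 3 * q)) + 16 * 2 ^ (q + q) * (suc q * (q + 5))
                                                                          ≡⟨ identity q (2 ^ (q + q)) ⟩
    suc q * suc q * (112 * 2 ^ (q + q))                                   ∎)
    where
    open ≤-Reasoning
    identity : ∀ q p → 16 * p * (suc q * (1 + 3 * q) + suc q * (1 + 3 * q)) + 16 * p * (suc q * (q + 5)) ≡ suc q * suc q * (112 * p)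
    identity = solve-∀
  ... | q , inj₂ refl = *-cancelˡ-≤ (suc q * suc (suc q)) (begin
    suc q * suc (suc q) * (N ^ 3 * paths (suc (q + q)) n 1)              ≡⟨ cong (λ t → suc q * suc (suc q) * (N ^ 3 * paths t n 1)) (+-suc q q) ⟨
    suc q * suc (suc q) * (N ^ 3 * paths (q + suc q) n 1)                ≤⟨ [1+a][1+b]*N³*paths≤ q (suc q) ⟩
    16 * p * (suc (suc q) * (1 + 3 * suc q) + suc q * (1 + 3 * q))        ≤⟨ m≤m+n _ _ ⟩
    16 * p * (suc (suc q) * (1 + 3 * suc q) + suc q * (1 + 3 * q)) + 16 * p * (q * q + 7 * q + 5)
                                                                          ≡⟨ identity q p ⟩
    suc q * suc (suc q) * (112 * p)                                       ≡⟨ cong (λ t → suc q * suc (suc q) * (112 * 2 ^ t)) (+-suc q q) ⟩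
    suc q * suc (suc q) * (112 * 2 ^ suc (q + q))                         ∎)
    where
    open ≤-Reasoning
    p = 2 ^ (q + suc q)
    identity : ∀ q p → 16 * p * (suc (suc q) * (1 + 3 * suc q) + suc q * (1 + 3 * q)) + 16 * p * (q * q + 7 * q + 5)
                     ≡ suc q * suc (suc q) * (112 * p)
    identity = solve-∀

  quartic-n≤2n³ : 4 ≤ n → quartic n ≤ 2 * n ^ 3
  quartic-n≤2n³ 4≤n = begin
    n * (N ∸ n) * (N * N + 1 + n * (N ∸ n))    ≡⟨ cong (λ d → n * d * (N * N + 1 + n * d)) (m+n∸n≡m 1 n) ⟩
    n * 1 * (suc n * suc n + 1 + n * 1)        ≡⟨ cong (λ m → m * 1 * (suc m * suc m + 1 + m * 1)) (m∸n+n≡m 4≤n) ⟨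
    q (s + 4)                                  ≤⟨ m≤m+n _ _ ⟩
    q (s + 4) + (s * s * s + 9 * s * s + 22 * s + 8) ≡⟨ identity s ⟩
    2 * (s + 4) ^ 3                            ≡⟨ cong (λ m → 2 * m ^ 3) (m∸n+n≡m 4≤n) ⟩
    2 * n ^ 3                                  ∎
    where
    open ≤-Reasoning
    s = n ∸ 4
    q : ℕ → ℕ
    q m = m * 1 * (suc m * suc m + 1 + m * 1)
    identity : ∀ s → (s + 4) * 1 * (suc (s + 4) * suc (s + 4) + 1 + (s + 4) * 1) + (s * s * s + 9 * s * s + 22 * s + 8)
                   ≡ 2 * ((s + 4) * ((s + 4) * ((s + 4) * 1)))
    identity = solve-∀

  [3q+r]³*paths≤64*n³*2^[3q+r] : 4 ≤ n → ∀ q r → 6 ≤ q → r ≤ 2 →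
                                 let t = q + q + (q + r) in t ^ 3 * paths t n 1 ≤ 64 * n ^ 3 * 2 ^ t
  [3q+r]³*paths≤64*n³*2^[3q+r] 4≤n q r 6≤q r≤2 = begin
    t ^ 3 * paths t n 1                  ≤⟨ *-monoˡ-≤ (paths t n 1) ([3q+r]³≤32q²[1+q+r] q r 6≤q r≤2) ⟩
    32 * (q * q * suc (q + r)) * paths t n 1
                                         ≡⟨ regroup q (suc (q + r)) (paths t n 1) ⟩
    32 * (q * q * (suc (q + r) * paths t n 1))
                                         ≤⟨ *-monoʳ-≤ 32 (paths-decay q q (q + r)) ⟩
    32 * (2 ^ t * quartic n)             ≤⟨ *-monoʳ-≤ 32 (*-monoʳ-≤ (2 ^ t) (quartic-n≤2n³ 4≤n)) ⟩
    32 * (2 ^ t * (2 * n ^ 3))           ≡⟨ collect (2 ^ t) (n ^ 3) ⟩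
    64 * n ^ 3 * 2 ^ t                   ∎
    where
    open ≤-Reasoning
    t = q + q + (q + r)
    regroup : ∀ q m p → 32 * (q * q * m) * p ≡ 32 * (q * q * (m * p))
    regroup = solve-∀
    collect : ∀ p c → 32 * (p * (2 * c)) ≡ 64 * c * p
    collect = solve-∀

  t³*paths≤64*n³*2^t : 5 ≤ n → ∀ t → t ^ 3 * paths t n 1 ≤ 64 * n ^ 3 * 2 ^ t
  t³*paths≤64*n³*2^t 5≤n t with t ≤? 4 * n
  ... | yes t≤4n = begin
    t ^ 3 * paths t n 1         ≤⟨ *-mono-≤ (^-monoˡ-≤ 3 t≤4n) (paths≤2^t t n 1) ⟩
    (4 * n) ^ 3 * 2 ^ t         ≡⟨ cong (_* 2 ^ t) (cube n) ⟩
    64 * n ^ 3 * 2 ^ t          ∎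
    where
    open ≤-Reasoning
    cube : ∀ n → (4 * n) * ((4 * n) * ((4 * n) * 1)) ≡ 64 * (n * (n * (n * 1)))
    cube = solve-∀
  ... | no t≰4n = subst (λ t → t ^ 3 * paths t n 1 ≤ 64 * n ^ 3 * 2 ^ t) (sym t≡3q+r)
                        ([3q+r]³*paths≤64*n³*2^[3q+r] (≤-trans (n≤1+n 4) 5≤n) q r 6≤q r≤2)
    where
    q = t / 3
    r = t % 3
    r≤2 : r ≤ 2
    r≤2 = s≤s⁻¹ (m%n<n t 3)
    t≡3q+r : t ≡ q + q + (q + r)
    t≡3q+r = trans (m≡m%n+[m/n]*n t 3) (rearrange r q)
      where
      rearrange : ∀ r q → r + q * 3 ≡ q + q + (q + r)
      rearrange = solve-∀
    6≤q : 6 ≤ q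
    6≤q with 6 ≤? q
    ... | yes 6≤q = 6≤q
    ... | no  6≰q = contradiction (≤-trans (*-monoʳ-≤ 4 5≤n) (≤-trans (n≤1+n _) (≤-trans (≰⇒> t≰4n) t≤17))) (from-no (20 ≤? 17))
      where
      q≤5 : q ≤ 5
      q≤5 = s≤s⁻¹ (≰⇒> 6≰q)
      t≤17 : t ≤ 17
      t≤17 = ≤-trans (≤-reflexive t≡3q+r) (+-mono-≤ (+-mono-≤ q≤5 q≤5) (+-mono-≤ q≤5 r≤2))

  Inside : ℤ → Set
  Inside i = ℤ.+ 1 ℤ.≤ i × i ℤ.≤ ℤ.+ n

  Stays : ℤ → ∀ {t} → Pred (Vec Bool t) 0ℓ
  Stays i bs = endPos i bs ≡ ℤ.+ n × maxPos i bs ℤ.≤ ℤ.+ n × ℤ.+ 1 ℤ.≤ minPos i bs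

  stays? : ∀ i {t} → Decidable (Stays i {t})
  stays? i bs = endPos i bs ℤ.≟ ℤ.+ n ×-dec (maxPos i bs ℤ.≤? ℤ.+ n ×-dec ℤ.+ 1 ℤ.≤? minPos i bs)

  Stays-∷⁻ : ∀ {t} i b (bs : Vec Bool t) → Stays i (b ∷ bs) → Inside i × Stays (i ℤ.+ stepℤ b) bs
  Stays-∷⁻ i b bs (end≡n , max≤n , 1≤min) =
    (ℤ.i≤j⊓k⇒i≤j i _ 1≤min′ , ℤ.i⊔j≤k⇒i≤k i _ max≤n′) ,
    (trans (sym (endPos-∷ i b bs)) end≡n , ℤ.i⊔j≤k⇒j≤k i _ max≤n′ , ℤ.i≤j⊓k⇒i≤k i _ 1≤min′)
    where
    max≤n′ = subst (ℤ._≤ ℤ.+ n) (maxPos-∷ i b bs) max≤n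
    1≤min′ = subst (ℤ.+ 1 ℤ.≤_) (minPos-∷ i b bs) 1≤min

  Stays-∷⁺ : ∀ {t} i b (bs : Vec Bool t) → Inside i → Stays (i ℤ.+ stepℤ b) bs → Stays i (b ∷ bs)
  Stays-∷⁺ i b bs (1≤i , i≤n) (end≡n , max≤n , 1≤min) =
    trans (endPos-∷ i b bs) end≡n ,
    subst (ℤ._≤ ℤ.+ n) (sym (maxPos-∷ i b bs)) (ℤ.⊔-lub i≤n max≤n) ,
    subst (ℤ.+ 1 ℤ.≤_) (sym (minPos-∷ i b bs)) (ℤ.⊓-glb 1≤i 1≤min)

  count : ℤ → ℕ → ℕ
  count i t = length (filter (stays? i) (allSteps t))

  count-∷ : ∀ i t b → Inside i →
            length (filter (stays? i) (map (b ∷_) (allSteps t))) ≡ count (i ℤ.+ stepℤ b) t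
  count-∷ i t b inside = trans (length-filter-map (b ∷_) (stays? i) (allSteps t))
    (cong length (filter-≐ _ (stays? (i ℤ.+ stepℤ b))
                           ((λ {bs} → proj₂ ∘ Stays-∷⁻ i b bs) , (λ {bs} → Stays-∷⁺ i b bs inside)) (allSteps t)))

  count-inside : ∀ i t → Inside i → count i (suc t) ≡ count (i ℤ.+ stepℤ true) t + count (i ℤ.+ stepℤ false) t
  count-inside i t inside = begin
    count i (suc t)   ≡⟨ cong length (filter-++ (stays? i) (map (true ∷_) (allSteps t)) _) ⟩
    length (filter (stays? i) (map (true ∷_) (allSteps t)) ++ filter (stays? i) (map (false ∷_) (allSteps t)))
                      ≡⟨ length-++ (filter (stays? i) (map (true ∷_) (allSteps t))) ⟩
    length (filter (stays? i) (map (true ∷_) (allSteps t))) + length (filter (stays? i) (map (false ∷_) (allSteps t)))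
                      ≡⟨ cong₂ _+_ (count-∷ i t true inside) (count-∷ i t false inside) ⟩
    count (i ℤ.+ stepℤ true) t + count (i ℤ.+ stepℤ false) t ∎
    where open ≡-Reasoning

  count-outside : ∀ i t → ¬ Inside i → count i (suc t) ≡ 0
  count-outside i t outside =
    cong length (filter-none (stays? i) (All.universal (λ { (b ∷ bs) → outside ∘ proj₁ ∘ Stays-∷⁻ i b bs }) (allSteps (suc t))))

  count≡paths : ∀ t x → count (ℤ.+ x) t ≡ paths t n x
  count≡paths zero    x       = at-start (x ≟ n)
    where
    at-start : Dec (x ≡ n) → count (ℤ.+ x) 0 ≡ δ n x
    at-start (yes refl) = trans (cong length (filter-accept (stays? (ℤ.+ n)) {x = []} {xs = []} (refl , ℤ.≤-refl , ℤ.+≤+ (s≤s z≤n)))) (sym (δ-≡ n))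
    at-start (no x≢n)   = trans (cong length (filter-reject (stays? (ℤ.+ x)) {x = []} {xs = []} (x≢n ∘ ℤ.+-injective ∘ proj₁))) (sym (δ-≢ x≢n))
  count≡paths (suc t) zero    = count-outside (ℤ.+ 0) t λ { (ℤ.+≤+ () , _) }
  count≡paths (suc t) (suc y) = one-step (suc y ≤? n)
    where
    open ≡-Reasoning
    one-step : Dec (suc y ≤ n) → count (ℤ.+ suc y) (suc t) ≡ step (paths t n) (suc y)
    one-step (yes x≤n) = begin
      count (ℤ.+ suc y) (suc t)                      ≡⟨ count-inside (ℤ.+ suc y) t (ℤ.+≤+ (s≤s z≤n) , ℤ.+≤+ x≤n) ⟩
      count (ℤ.+ (suc y + 1)) t + count (ℤ.+ y) t    ≡⟨ cong (λ m → count (ℤ.+ m) t + count (ℤ.+ y) t) (+-comm (suc y) 1) ⟩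
      count (ℤ.+ suc (suc y)) t + count (ℤ.+ y) t    ≡⟨ cong₂ _+_ (count≡paths t (suc (suc y))) (count≡paths t y) ⟩
      paths t n (suc (suc y)) + paths t n y          ≡⟨ +-comm _ (paths t n y) ⟩
      nbr (paths t n) (suc y)                        ≡⟨ step-inside (paths t n) (s≤s z≤n) x≤n ⟨
      step (paths t n) (suc y)                       ∎
    one-step (no x≰n) = trans (count-outside (ℤ.+ suc y) t λ { (_ , ℤ.+≤+ x≤n) → x≰n x≤n }) (sym (step-outside _ (≰⇒> x≰n)))

  event-count≡paths : ∀ t → length (filter (event? n t) (allSteps t)) ≡ paths t n 1
  event-count≡paths t = trans
    (cong length (filter-≐ (event? n t) (stays? (ℤ.+ 1)) ((λ {bs} → Event⇒Stays {bs}) , (λ {bs} → Stays⇒Event {bs})) (allSteps t)))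
    (count≡paths t 1)
    where
    Event⇒Stays : ∀ {bs} → Event n t bs → Stays (ℤ.+ 1) bs
    Event⇒Stays (end≡n , max≡n , 1≤min) = end≡n , ℤ.≤-reflexive max≡n , 1≤min
    Stays⇒Event : ∀ {bs} → Stays (ℤ.+ 1) bs → Event n t bs
    Stays⇒Event {bs} (end≡n , max≤n , 1≤min) =
      end≡n , ℤ.≤-antisym max≤n (subst (ℤ._≤ maxPos (ℤ.+ 1) bs) end≡n (endPos≤maxPos (ℤ.+ 1) bs)) , 1≤min

  prob≡paths/2^t : ∀ t → prob t (event? n t) ≡ (ℤ.+ paths t n 1 ℚ./ 2 ^ t) {{m^n≢0 2 t}}
  prob≡paths/2^t t = cong (λ L → (ℤ.+ L ℚ./ 2 ^ t) {{m^n≢0 2 t}}) (event-count≡paths t)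

  -- expPartial (ℤ.+ 25 ℚ./ 1) 3 = 1 + 25 + 625/2 computes to ℤ.+ 677 ℚ./ 2.
  prob≤e₃/n³ : ∀ t → prob t (event? n t) ℚ.≤ expPartial (ℤ.+ 25 ℚ./ 1) 3 ℚ.* ratio 1 (n ^ 3)
  prob≤e₃/n³ t = subst₂ ℚ._≤_ (sym (prob≡paths/2^t t)) (sym (/-*-/ 677 2 1 (n ^ 3)))
    (/-mono-≤ (paths t n 1) (2 ^ t) (677 * 1) (2 * n ^ 3) {{m^n≢0 2 t}} (begin
      paths t n 1 * (2 * n ^ 3)          ≡⟨ regroup (paths t n 1) (n ^ 3) ⟩
      2 * (n ^ 3 * paths t n 1)          ≤⟨ *-monoʳ-≤ 2 (*-monoˡ-≤ (paths t n 1) (^-monoˡ-≤ 3 (n≤1+n n))) ⟩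
      2 * (N ^ 3 * paths t n 1)          ≤⟨ *-monoʳ-≤ 2 (N³*paths≤112*2^t t) ⟩
      2 * (112 * 2 ^ t)                  ≡⟨ *-assoc 2 112 (2 ^ t) ⟨
      224 * 2 ^ t                        ≤⟨ *-monoˡ-≤ (2 ^ t) (from-yes (224 ≤? 677)) ⟩
      677 * 1 * 2 ^ t                    ∎))
    where
    open ≤-Reasoning
    regroup : ∀ x c → x * (2 * c) ≡ 2 * (c * x)
    regroup = solve-∀

  prob≤64[n/t]³ : 5 ≤ n → ∀ t-1 → let t = suc t-1 in
                  prob t (event? n t) ℚ.≤ (ℤ.+ 64 ℚ./ 1) ℚ.* (ratio n t ^ℚ 3)
  prob≤64[n/t]³ 5≤n t-1 = subst₂ ℚ._≤_ (sym (prob≡paths/2^t t))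
    (sym (trans (cong ((ℤ.+ 64 ℚ./ 1) ℚ.*_) (/-^ℚ n t 3)) (/-*-/ 64 1 (n ^ 3) (t ^ 3))))
    (/-mono-≤ (paths t n 1) (2 ^ t) (64 * n ^ 3) (1 * t ^ 3) {{m^n≢0 2 t}}
      (≤-trans (≤-reflexive (trans (cong (paths t n 1 *_) (*-identityˡ (t ^ 3))) (*-comm _ (t ^ 3))))
               (t³*paths≤64*n³*2^t 5≤n t)))
    where
    t = suc t-1

open import Data.Integer using (+_)

mainTheorem4 : (n t : ℕ) → 20 ≤ n → n ∸ 1 ≤ t →
    let p = prob t (event? n t) in
    LeExpTimes p (+ 25 ℚ./ 1) (ratio 1 (n ℕ.^ 3))
    × (p ℚ.≤ (+ 64 ℚ./ 1) ℚ.* (ratio n t ^ℚ 3))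
mainTheorem4 zero        _           ()
mainTheorem4 (suc n-1)   zero        20≤n n∸1≤0 = contradiction (≤-trans (s≤s⁻¹ 20≤n) n∸1≤0) λ ()
mainTheorem4 n@(suc n-1) t@(suc t-1) 20≤n _    = p≤e²⁵/n³ , prob≤64[n/t]³ (≤-trans (from-yes (5 ≤? 20)) 20≤n) t-1
  where
  open Strip n-1 using (prob≤e₃/n³; prob≤64[n/t]³)
  p≤e²⁵/n³ : LeExpTimes (prob t (event? n t)) (+ 25 ℚ./ 1) (ratio 1 (n ℕ.^ 3))
  p≤e²⁵/n³ ε 0<ε = 3 , ℚ.≤-trans (prob≤e₃/n³ t) (p≤p+q _ 0<ε)
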